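{- Let $s\ge2$ be an integer, let $a_s=(2s-1,2s)(4s-1,4s)$ and $b_s=(1,3,5,\dots,4s-1,2,4,6,\dots,4s)$ in $\mathrm{Sym}(4s)$, $R_s=\langle a_s,b_s\rangle$, and $\Gamma_s=\mathrm{Cay}(R_s,\{a_sb_s,b_s\})$. Then: (a) $|V(\Gamma_s)|=2^{s+1}s$; (b) $\Gamma_s$ is regular of valency $2$; (c) $\Gamma_s$ is strongly connected; (d) $\Gamma_s$ is $s$-arc-transitive; (e) $\Gamma_s$ is non-diagonalizable.
   Context: Permutations are composed left to right (the product $xy$ means first $x$, then $y$). $\mathrm{Cay}(R,S)$ is the digraph with vertex set $R$ and $x\to y$ iff $yx^{ -1}\in S$. A digraph is regular of valency $d$ if every vertex has exactly $d$ out-neighbours and $d$ in-neighbours. An $s$-arc is a sequence $v_0,\dots,v_s$ of vertices with $v_i\to v_{i+1}$ for all $i$; $s$-arc-transitive means the automorphism group is transitive on $s$-arcs. Non-diagonalizable means the adjacency matrix is not diagonalizable over $\mathbb{C}$. -}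

module Defs where

open import Level using (Level; _⊔_) renaming (suc to lsuc)
open import Data.Nat as ℕ using (ℕ; zero; suc; _∸_; _<?_; _≡ᵇ_)
open import Data.Bool using (if_then_else_)
open import Data.Fin using (Fin; toℕ; fromℕ<)
open import Data.Vec using (Vec; tabulate; lookup; map)
open import Data.List using (List; length)
open import Data.List.Relation.Unary.Unique.Propositional using (Unique)
open import Data.List.Membership.Propositional using (_∈_)
open import Data.Product using (Σ; ∃; _×_; _,_)
open import Data.Sum using (_⊎_)
open import Relation.Nullary using (¬_; yes; no)
open import Relation.Binary.PropositionalEquality using (_≡_)
open import Relation.Binary.Construct.Closure.ReflexiveTransitive using (Star)
open import Function.Bundles using (_⇔_)
open import Algebra.Bundles using (CommutativeRing)

-- Permutations of {0,…,n-1} (the points 1,…,n of the paper, shifted by 1),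
-- represented by their table of images: lookup p i = image of i under p.

Perm : ℕ → Set
Perm n = Vec (Fin n) n

idP : ∀ {n} → Perm n
idP = tabulate (λ i → i)

-- Left-to-right composition: p · q means first p, then q.
_·_ : ∀ {n} → Perm n → Perm n → Perm n
p · q = tabulate (λ i → lookup q (lookup p i))

data InGen {n : ℕ} (a b : Perm n) : Perm n → Set where
  gen-id  : InGen a b idP
  gen-a   : InGen a b a
  gen-b   : InGen a b b
  gen-mul : ∀ {p q} → InGen a b p → InGen a b q → InGen a b (p · q)
  gen-inv : ∀ {p q} → InGen a b p → p · q ≡ idP → InGen a b q

-- a number m as an element of Fin n, with default value d (never used
-- below for s ≥ 2, since all values are in range)
finOr : ∀ {n} → Fin n → ℕ → Fin n
finOr {n} d m with m <? n
... | yes p = fromℕ< p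
... | no _  = d

mkPerm : (n : ℕ) → (ℕ → ℕ) → Perm n
mkPerm n f = tabulate (λ i → finOr i (f (toℕ i)))

-- a_s = (2s-1, 2s)(4s-1, 4s) in 1-indexed notation
aFun : ℕ → ℕ → ℕ
aFun s m =
  if m ≡ᵇ (2 ℕ.* s ∸ 2) then 2 ℕ.* s ∸ 1 else
  if m ≡ᵇ (2 ℕ.* s ∸ 1) then 2 ℕ.* s ∸ 2 else
  if m ≡ᵇ (4 ℕ.* s ∸ 2) then 4 ℕ.* s ∸ 1 else
  if m ≡ᵇ (4 ℕ.* s ∸ 1) then 4 ℕ.* s ∸ 2 else m

-- b_s = (1,3,5,…,4s-1,2,4,6,…,4s) in 1-indexed notation:
-- 1-indexed: i ↦ i+2 for i ≤ 4s-2, 4s-1 ↦ 2, 4s ↦ 1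
bFun : ℕ → ℕ → ℕ
bFun s m =
  if (m ℕ.+ 2) ℕ.<ᵇ (4 ℕ.* s) then m ℕ.+ 2 else
  if m ≡ᵇ (4 ℕ.* s ∸ 2) then 1 else 0

a : (s : ℕ) → Perm (4 ℕ.* s)
a s = mkPerm (4 ℕ.* s) (aFun s)

b : (s : ℕ) → Perm (4 ℕ.* s)
b s = mkPerm (4 ℕ.* s) (bFun s)

R : (s : ℕ) → Perm (4 ℕ.* s) → Set
R s = InGen (a s) (b s)

CayArc : ∀ {n} → (Perm n → Set) → List (Perm n) → Perm n → Perm n → Set
CayArc V S x y = V x × V y × Σ _ (λ z → (x · z ≡ idP) × ((y · z) ∈ S))

ΓArc : (s : ℕ) → Perm (4 ℕ.* s) → Perm (4 ℕ.* s) → Set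
ΓArc s = CayArc (R s) (a s · b s Data.List.∷ b s Data.List.∷ Data.List.[])

HasCard : ∀ {ℓ} {A : Set} → (A → Set ℓ) → ℕ → Set ℓ
HasCard {A = A} P k =
  Σ (List A) (λ l → (length l ≡ k) × Unique l × (∀ x → P x ⇔ (x ∈ l)))

RegularOfValency : ∀ {A : Set} → (A → Set) → (A → A → Set) → ℕ → Set
RegularOfValency V E d =
  ∀ x → V x → HasCard (λ y → E x y) d × HasCard (λ y → E y x) d

StronglyConnected : ∀ {A : Set} → (A → Set) → (A → A → Set) → Set
StronglyConnected V E = ∀ x y → V x → V y → Star E x y

record Automorphism {A : Set} (V : A → Set) (E : A → A → Set) : Set where
  field
    f g    : A → A
    f-V    : ∀ x → V x → V (f x)
    g-V    : ∀ x → V x → V (g x)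
    gf     : ∀ x → V x → g (f x) ≡ x
    fg     : ∀ x → V x → f (g x) ≡ x
    f-arc  : ∀ x y → V x → V y → (E x y ⇔ E (f x) (f y))

data IsArcSeq {A : Set} (V : A → Set) (E : A → A → Set) : ∀ {k} → Vec A (suc k) → Set where
  one  : ∀ {v} → V v → IsArcSeq V E (v Data.Vec.∷ Data.Vec.[])
  cons : ∀ {k v w} {vs : Vec A k} → E v w → IsArcSeq V E (w Data.Vec.∷ vs)
       → IsArcSeq V E (v Data.Vec.∷ w Data.Vec.∷ vs)

ArcTransitive : ∀ {A : Set} → (A → Set) → (A → A → Set) → ℕ → Set
ArcTransitive V E k =
  ∀ (α β : Vec _ (suc k)) → IsArcSeq V E α → IsArcSeq V E β →
  Σ (Automorphism V E) (λ φ → map (Automorphism.f φ) α ≡ β)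

record Field c ℓ : Set (lsuc (c ⊔ ℓ)) where
  field
    commRing : CommutativeRing c ℓ
  open CommutativeRing commRing public
  field
    nontrivial : ¬ (1# ≈ 0#)
    inverse    : ∀ x → ¬ (x ≈ 0#) → Σ Carrier (λ y → (x * y) ≈ 1#)

module FieldOps {c ℓ} (K : Field c ℓ) where
  open Field K

  Σᶠ : ∀ {k} → (Fin k → Carrier) → Carrier
  Σᶠ {zero}  _ = 0#
  Σᶠ {suc k} v = v Data.Fin.zero + Σᶠ (λ i → v (Data.Fin.suc i))

  pow : Carrier → ℕ → Carrier
  pow x zero    = 1#
  pow x (suc n) = x * pow x n

  natK : ℕ → Carrier
  natK zero    = 0#
  natK (suc n) = 1# + natK n

  Mat : ℕ → Set c
  Mat k = Fin k → Fin k → Carrier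

  _⊗_ : ∀ {k} → Mat k → Mat k → Mat k
  (M ⊗ N) i j = Σᶠ (λ l → M i l * N l j)

  IdM : ∀ {k} → Mat k
  IdM i j = if (toℕ i ≡ᵇ toℕ j) then 1# else 0#

  Diagonalizable : ∀ {k} → Mat k → Set (c ⊔ ℓ)
  Diagonalizable {k} M =
    Σ (Mat k) λ P → Σ (Mat k) λ Q →
      (∀ i j → (P ⊗ Q) i j ≈ IdM i j) × (∀ i j → (Q ⊗ P) i j ≈ IdM i j) ×
      (∀ i j → ¬ (i ≡ j) → ((Q ⊗ M) ⊗ P) i j ≈ 0#)

record AlgClosedChar0 c ℓ : Set (lsuc (c ⊔ ℓ)) where
  field
    field' : Field c ℓ
  open Field field' public
  open FieldOps field' public
  field
    char0      : ∀ n → ¬ (natK (suc n) ≈ 0#)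
    algClosed  : ∀ n (coef : Fin (suc n) → Carrier) →
                 Σ Carrier (λ x → (pow x (suc n) + Σᶠ (λ i → coef i * pow x (toℕ i))) ≈ 0#)

NonDiagonalizableOver : ∀ {c ℓ} {A : Set} → AlgClosedChar0 c ℓ →
                        (A → Set) → (A → A → Set) → Set (c ⊔ ℓ)
NonDiagonalizableOver {A = A} K V E =
  ∀ (l : List A) → Unique l → (∀ x → V x ⇔ (x ∈ l)) →
  ∀ (M : Mat (length l)) →
  (∀ i j → (E (Data.List.lookup l i) (Data.List.lookup l j) → M i j ≈ 1#) ×
           (¬ E (Data.List.lookup l i) (Data.List.lookup l j) → M i j ≈ 0#)) →
  ¬ Diagonalizable M
  where open AlgClosedChar0 K

-- Arrange the 4s points in 2s columns of two rows. Every element of R_s is a permutation encode (k , v)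
-- shifting the columns by k (mod 2s) and swapping the rows of column q according to the bit v_(q mod s)
-- of v ∈ 𝔽₂^s (with one more swap when a column wraps around). Left multiplication by a flips bit s - 1
-- of v, left multiplication by b shifts k and rotates v; all 2s · 2^s such codes are reached and encode
-- is injective, which gives the order. The out-neighbours b x and a b x of x = encode (k , v) differ
-- only in one bit, so Γ_s is 2-regular, and walks along a and b reach every vertex. Besides right
-- multiplications, Γ_s has the twists, which flip bits of codes according to a set of columns: twisting
-- column k + s fixes encode (k , v) and exchanges its two out-neighbours, and composing such twists
-- along the columns k + s, …, k + 2s - 1 matches any two s-arcs with the same initial vertex. Finally,
-- for u = e_b - e_(b a) the adjacency matrix M satisfies M² u = 0 (the two out-neighbours of any vertex
-- have exchanged arcs into b and b a) while (M u)_1 = 1, so M is not diagonalizable.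

module Submission where

open import Defs
open import Level using (0ℓ)
open import Data.Bool using (Bool; true; false; not; _xor_; _∧_; _∨_; if_then_else_)
open import Data.Bool.Properties
  using (T-≡; ¬-not; xor-assoc; xor-comm; xor-identityʳ; xor-same; not-involutive;
         not-distribˡ-xor; not-distribʳ-xor; ∧-identityʳ; ∧-zeroʳ; ∨-identityʳ)
open import Data.Empty using (⊥-elim)
open import Data.Fin as Fin using (Fin; toℕ)
import Data.Fin.Properties as Finₚ
open import Data.List as List using (List; length; _++_)
open import Data.List.Membership.Propositional using (_∈_)
open import Data.List.Membership.Propositional.Properties using (∈-lookup; ∈-map⁺; ∈-map⁻; ∈-++⁺ˡ; ∈-++⁺ʳ; ∈-++⁻)
open import Data.List.Properties using (length-++; length-map)
open import Data.List.Relation.Unary.All as All using (All; []; _∷_)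
open import Data.List.Relation.Unary.AllPairs using ([]; _∷_)
open import Data.List.Relation.Unary.Any using (here; there; index)
open import Data.List.Relation.Unary.Any.Properties using (lookup-index)
open import Data.List.Relation.Unary.Unique.Propositional using (Unique)
import Data.List.Relation.Unary.Unique.Propositional.Properties as Unique
open import Data.Nat using (ℕ; zero; suc; _<_; _≡ᵇ_; _<ᵇ_; _≟_)
open import Data.Nat.Properties using (≡ᵇ⇒≡; ≡⇒≡ᵇ; <ᵇ⇒<; <⇒<ᵇ)
open import Data.Product using (Σ; ∃; _×_; _,_; proj₁; proj₂)
open import Data.Sum using (_⊎_; inj₁; inj₂; [_,_]′)
open import Data.Vec as Vec using (Vec; []; _∷_)
open import Data.Vec.Properties using (lookup∘tabulate; tabulate∘lookup; tabulate-cong; map-∘; ≡-dec)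
open import Function.Bundles using (_⇔_; mk⇔; Equivalence)
import Function.Properties.Equivalence as ⇔
open import Relation.Binary.Construct.Closure.ReflexiveTransitive using (Star; ε; _◅_; _◅◅_)
open import Relation.Binary.PropositionalEquality
  using (_≡_; _≢_; refl; sym; trans; cong; cong₂; subst; subst₂; module ≡-Reasoning)
open import Relation.Nullary using (¬_; Dec; yes; no)
open import Relation.Nullary.Decidable using (map′)
open import Relation.Nullary.Negation using (¬¬-map)

if-true : ∀ {a} {A : Set a} {b : Bool} {x y : A} → b ≡ true → (if b then x else y) ≡ x
if-true refl = refl

if-false : ∀ {a} {A : Set a} {b : Bool} {x y : A} → b ≡ false → (if b then x else y) ≡ y
if-false refl = refl

≡ᵇ-true : ∀ {m n} → m ≡ n → (m ≡ᵇ n) ≡ true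
≡ᵇ-true {m} {n} m≡n = Equivalence.to T-≡ (≡⇒≡ᵇ m n m≡n)

≡ᵇ-false : ∀ {m n} → m ≢ n → (m ≡ᵇ n) ≡ false
≡ᵇ-false {m} {n} m≢n = ¬-not λ eq → m≢n (≡ᵇ⇒≡ m n (Equivalence.from T-≡ eq))

<ᵇ-true : ∀ {m n} → m < n → (m <ᵇ n) ≡ true
<ᵇ-true m<n = Equivalence.to T-≡ (<⇒<ᵇ m<n)

<ᵇ-false : ∀ {m n} → ¬ m < n → (m <ᵇ n) ≡ false
<ᵇ-false {m} {n} m≮n = ¬-not λ eq → m≮n (<ᵇ⇒< m n (Equivalence.from T-≡ eq))

≡ᵇ-cong : ∀ {a b c d} → (a ≡ b → c ≡ d) → (c ≡ d → a ≡ b) → (a ≡ᵇ b) ≡ (c ≡ᵇ d)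
≡ᵇ-cong {a} {b} to from with a ≟ b
... | yes a≡b = trans (≡ᵇ-true a≡b) (sym (≡ᵇ-true (to a≡b)))
... | no a≢b  = trans (≡ᵇ-false a≢b) (sym (≡ᵇ-false (λ c≡d → a≢b (from c≡d))))

xor-cancelʳ : ∀ a b → (a xor b) xor b ≡ a
xor-cancelʳ a b = begin
  (a xor b) xor b ≡⟨ xor-assoc a b b ⟩
  a xor (b xor b) ≡⟨ cong (a xor_) (xor-same b) ⟩
  a xor false     ≡⟨ xor-identityʳ a ⟩
  a               ∎
  where open ≡-Reasoning

xor-cancelˡ : ∀ a b → (a xor b) xor a ≡ b
xor-cancelˡ a b = trans (cong (_xor a) (xor-comm a b)) (xor-cancelʳ b a)

xor-swapʳ : ∀ a b c → (a xor b) xor c ≡ (a xor c) xor b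
xor-swapʳ a b c = begin
  (a xor b) xor c ≡⟨ xor-assoc a b c ⟩
  a xor (b xor c) ≡⟨ cong (a xor_) (xor-comm b c) ⟩
  a xor (c xor b) ≡⟨ xor-assoc a c b ⟨
  (a xor c) xor b ∎
  where open ≡-Reasoning

lookup-injective : ∀ {A : Set} {xs : List A} → Unique xs → ∀ i j → List.lookup xs i ≡ List.lookup xs j → i ≡ j
lookup-injective (x∉xs ∷ u) Fin.zero    Fin.zero    _  = refl
lookup-injective (x∉xs ∷ u) Fin.zero    (Fin.suc j) eq = ⊥-elim (All.lookup x∉xs (∈-lookup j) eq)
lookup-injective (x∉xs ∷ u) (Fin.suc i) Fin.zero    eq = ⊥-elim (All.lookup x∉xs (∈-lookup i) (sym eq))
lookup-injective (x∉xs ∷ u) (Fin.suc i) (Fin.suc j) eq = cong Fin.suc (lookup-injective u i j eq)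

¬¬-∀-Fin : ∀ {p} n (P : Fin n → Set p) → (∀ i → ¬ ¬ P i) → ¬ ¬ (∀ i → P i)
¬¬-∀-Fin zero    P ¬¬P ¬∀P = ¬∀P (λ ())
¬¬-∀-Fin (suc n) P ¬¬P ¬∀P = ¬¬P Fin.zero λ P0 →
  ¬¬-∀-Fin n (λ i → P (Fin.suc i)) (λ i → ¬¬P (Fin.suc i)) λ P+ →
  ¬∀P λ { Fin.zero → P0 ; (Fin.suc i) → P+ i }

module LinearAlgebra {c ℓ} (K : Field c ℓ) where
  open Field K using (Carrier; _≈_; _+_; _*_; -_; _-_; 0#; 1#; inverse; nontrivial; semiring; ring; setoid; -‿cong; -‿inverseʳ;
    +-cong; +-congˡ; +-congʳ; +-comm; +-identityˡ; +-identityʳ; *-congˡ; *-congʳ; *-assoc;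
    *-identityˡ; *-identityʳ; zeroˡ; zeroʳ)
    renaming (sym to ≈-sym; trans to ≈-trans; reflexive to ≈-reflexive)
  open FieldOps K
  open import Algebra.Properties.Ring ring using (-1*x≈-x; x[y-z]≈xy-xz; -0#≈0#; ⁻¹-anti-homo‿-)
  open import Algebra.Properties.Semiring.Sum semiring
    using (sum; sum-cong-≋; sum-replicate-zero; ∑-distrib-+; ∑-comm; *-distribˡ-sum; *-distribʳ-sum)
  open import Relation.Binary.Reasoning.Setoid setoid

  Vector : ℕ → Set c
  Vector n = Fin n → Carrier

  Σᶠ≡sum : ∀ {n} (v : Vector n) → Σᶠ v ≡ sum v
  Σᶠ≡sum {zero}  v = refl
  Σᶠ≡sum {suc n} v = cong (v Fin.zero +_) (Σᶠ≡sum (λ i → v (Fin.suc i)))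

  sum-zero : ∀ {n} (v : Vector n) → (∀ i → v i ≈ 0#) → sum v ≈ 0#
  sum-zero {n} v v≈0 = ≈-trans (sum-cong-≋ v≈0) (sum-replicate-zero n)

  sum-neg : ∀ {n} (v : Vector n) → sum (λ i → - v i) ≈ - sum v
  sum-neg v = begin
    sum (λ i → - v i)      ≈⟨ sum-cong-≋ (λ i → ≈-sym (-1*x≈-x (v i))) ⟩
    sum (λ i → - 1# * v i) ≈⟨ *-distribˡ-sum (- 1#) v ⟨
    - 1# * sum v           ≈⟨ -1*x≈-x (sum v) ⟩
    - sum v                ∎

  sum-single : ∀ {n} (v : Vector n) i → (∀ j → j ≢ i → v j ≈ 0#) → sum v ≈ v i
  sum-single {suc n} v Fin.zero    v≈0 = ≈-trans (+-congˡ (sum-zero _ (λ j → v≈0 (Fin.suc j) (λ ())))) (+-identityʳ _)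
  sum-single {suc n} v (Fin.suc i) v≈0 = ≈-trans (+-congʳ (v≈0 Fin.zero (λ ()))) (≈-trans (+-identityˡ _)
    (sum-single (λ j → v (Fin.suc j)) i (λ j j≢i → v≈0 (Fin.suc j) (λ eq → j≢i (Finₚ.suc-injective eq)))))

  sum-pair : ∀ {n} (v : Vector n) i j → i ≢ j → (∀ k → k ≢ i → k ≢ j → v k ≈ 0#) → sum v ≈ v i + v j
  sum-pair {suc n} v Fin.zero    Fin.zero    i≢j _   = ⊥-elim (i≢j refl)
  sum-pair {suc n} v Fin.zero    (Fin.suc j) _   v≈0 =
    +-congˡ (sum-single (λ k → v (Fin.suc k)) j (λ k k≢j → v≈0 (Fin.suc k) (λ ()) (λ eq → k≢j (Finₚ.suc-injective eq))))
  sum-pair {suc n} v (Fin.suc i) Fin.zero    _   v≈0 =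
    ≈-trans (+-congˡ (sum-single (λ k → v (Fin.suc k)) i (λ k k≢i → v≈0 (Fin.suc k) (λ eq → k≢i (Finₚ.suc-injective eq)) (λ ()))))
          (+-comm _ _)
  sum-pair {suc n} v (Fin.suc i) (Fin.suc j) i≢j v≈0 = ≈-trans (+-congʳ (v≈0 Fin.zero (λ ()) (λ ()))) (≈-trans (+-identityˡ _)
    (sum-pair (λ k → v (Fin.suc k)) i j (λ eq → i≢j (cong Fin.suc eq))
              (λ k k≢i k≢j → v≈0 (Fin.suc k) (λ eq → k≢i (Finₚ.suc-injective eq)) (λ eq → k≢j (Finₚ.suc-injective eq)))))

  infixr 7 _*ᵥ_

  _*ᵥ_ : ∀ {n} → Mat n → Vector n → Vector n
  (A *ᵥ u) i = sum (λ j → A i j * u j)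

  *ᵥ-congˡ : ∀ {n} (A : Mat n) {u u′ : Vector n} → (∀ j → u j ≈ u′ j) → ∀ i → (A *ᵥ u) i ≈ (A *ᵥ u′) i
  *ᵥ-congˡ A u≈u′ i = sum-cong-≋ (λ j → *-congˡ (u≈u′ j))

  *ᵥ-congʳ : ∀ {n} {A B : Mat n} (u : Vector n) → (∀ i j → A i j ≈ B i j) → ∀ i → (A *ᵥ u) i ≈ (B *ᵥ u) i
  *ᵥ-congʳ u A≈B i = sum-cong-≋ (λ j → *-congʳ (A≈B i j))

  *ᵥ-zero : ∀ {n} (A : Mat n) (u : Vector n) → (∀ j → u j ≈ 0#) → ∀ i → (A *ᵥ u) i ≈ 0#
  *ᵥ-zero A u u≈0 i = sum-zero _ (λ j → ≈-trans (*-congˡ (u≈0 j)) (zeroʳ _))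

  ⊗-*ᵥ : ∀ {n} (A B : Mat n) u i → ((A ⊗ B) *ᵥ u) i ≈ (A *ᵥ (B *ᵥ u)) i
  ⊗-*ᵥ A B u i = begin
    sum (λ j → Σᶠ (λ l → A i l * B l j) * u j)    ≈⟨ sum-cong-≋ (λ j → *-congʳ (≈-reflexive (Σᶠ≡sum (λ l → A i l * B l j)))) ⟩
    sum (λ j → sum (λ l → A i l * B l j) * u j)  ≈⟨ sum-cong-≋ (λ j → *-distribʳ-sum (u j) (λ l → A i l * B l j)) ⟩
    sum (λ j → sum (λ l → (A i l * B l j) * u j)) ≈⟨ ∑-comm (λ j l → (A i l * B l j) * u j) ⟩
    sum (λ l → sum (λ j → (A i l * B l j) * u j)) ≈⟨ sum-cong-≋ (λ l → sum-cong-≋ (λ j → *-assoc (A i l) (B l j) (u j))) ⟩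
    sum (λ l → sum (λ j → A i l * (B l j * u j))) ≈⟨ sum-cong-≋ (λ l → *-distribˡ-sum (A i l) (λ j → B l j * u j)) ⟨
    sum (λ l → A i l * sum (λ j → B l j * u j))   ∎

  IdM-diagonal : ∀ {n} (i : Fin n) → IdM i i ≈ 1#
  IdM-diagonal i = ≈-reflexive (if-true (≡ᵇ-true {toℕ i} refl))

  IdM-off-diagonal : ∀ {n} (i j : Fin n) → i ≢ j → IdM i j ≈ 0#
  IdM-off-diagonal i j i≢j = ≈-reflexive (if-false (≡ᵇ-false (λ eq → i≢j (Finₚ.toℕ-injective eq))))

  *ᵥ-IdM-column : ∀ {n} (A : Mat n) j i → (A *ᵥ (λ k → IdM k j)) i ≈ A i j
  *ᵥ-IdM-column A j i = ≈-trans (sum-single (λ k → A i k * IdM k j) j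
    (λ k k≢j → ≈-trans (*-congˡ (IdM-off-diagonal k j k≢j)) (zeroʳ (A i k))))
    (≈-trans (*-congˡ (IdM-diagonal j)) (*-identityʳ (A i j)))

  IdM-*ᵥ : ∀ {n} (u : Vector n) i → (IdM *ᵥ u) i ≈ u i
  IdM-*ᵥ u i = ≈-trans (sum-single (λ j → IdM i j * u j) i
    (λ j j≢i → ≈-trans (*-congʳ (IdM-off-diagonal i j (λ i≡j → j≢i (sym i≡j)))) (zeroˡ (u j))))
    (≈-trans (*-congʳ (IdM-diagonal i)) (*-identityˡ (u i)))

  x*[x*y]≈0⇒¬¬x*y≈0 : ∀ x y → x * (x * y) ≈ 0# → ¬ ¬ (x * y ≈ 0#)
  x*[x*y]≈0⇒¬¬x*y≈0 x y x²y≈0 xy≉0 = xy≉0 (begin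
    x * y  ≈⟨ *-congʳ x≈0 ⟩
    0# * y ≈⟨ zeroˡ y ⟩
    0#     ∎)
    where
    z = proj₁ (inverse (x * y) xy≉0)
    x≈0 : x ≈ 0#
    x≈0 = begin
      x                  ≈⟨ *-identityʳ x ⟨
      x * 1#             ≈⟨ *-congˡ (proj₂ (inverse (x * y) xy≉0)) ⟨
      x * ((x * y) * z)  ≈⟨ *-assoc x (x * y) z ⟨
      (x * (x * y)) * z  ≈⟨ *-congʳ x²y≈0 ⟩
      0# * z             ≈⟨ zeroˡ z ⟩
      0#                 ∎

  -- If P⁻¹ M P = D is diagonal, then D² w = 0 for w = P⁻¹ u, and in a field d² x = 0 forces d x = 0
  -- (only up to double negation, since ≈ need not be decidable); hence M u = P (D w) = 0.
  diagonalizable-M²u≈0⇒¬¬Mu≈0 : ∀ {n} (M : Mat n) (u : Vector n) → Diagonalizable M →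
    (∀ i → (M *ᵥ M *ᵥ u) i ≈ 0#) → ¬ ¬ (∀ i → (M *ᵥ u) i ≈ 0#)
  diagonalizable-M²u≈0⇒¬¬Mu≈0 {n} M u (P , Q , PQ≈I , _ , D-diagonal) M²u≈0 =
    ¬¬-map Dw≈0⇒Mu≈0 (¬¬-∀-Fin n (λ i → (D *ᵥ w) i ≈ 0#) ¬¬Dw≈0)
    where
    D = (Q ⊗ M) ⊗ P
    w = Q *ᵥ u
    PQ-*ᵥ : ∀ z i → (P *ᵥ Q *ᵥ z) i ≈ z i
    PQ-*ᵥ z i = ≈-trans (≈-sym (⊗-*ᵥ P Q z i)) (≈-trans (*ᵥ-congʳ z PQ≈I i) (IdM-*ᵥ z i))
    D-*ᵥ : ∀ z i → (D *ᵥ z) i ≈ (Q *ᵥ M *ᵥ P *ᵥ z) i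
    D-*ᵥ z i = ≈-trans (⊗-*ᵥ (Q ⊗ M) P z i) (⊗-*ᵥ Q M (P *ᵥ z) i)
    D-diag-*ᵥ : ∀ z i → (D *ᵥ z) i ≈ D i i * z i
    D-diag-*ᵥ z i = sum-single (λ j → D i j * z j) i
      (λ j j≢i → ≈-trans (*-congʳ (D-diagonal i j (λ i≡j → j≢i (sym i≡j)))) (zeroˡ (z j)))
    PDw≈Mu : ∀ j → (P *ᵥ D *ᵥ w) j ≈ (M *ᵥ u) j
    PDw≈Mu j = ≈-trans (*ᵥ-congˡ P (D-*ᵥ w) j) (≈-trans (PQ-*ᵥ (M *ᵥ P *ᵥ w) j) (*ᵥ-congˡ M (PQ-*ᵥ u) j))
    D²w≈0 : ∀ i → D i i * (D i i * w i) ≈ 0#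
    D²w≈0 i = begin
      D i i * (D i i * w i)  ≈⟨ *-congˡ (D-diag-*ᵥ w i) ⟨
      D i i * (D *ᵥ w) i     ≈⟨ D-diag-*ᵥ (D *ᵥ w) i ⟨
      (D *ᵥ D *ᵥ w) i        ≈⟨ D-*ᵥ (D *ᵥ w) i ⟩
      (Q *ᵥ M *ᵥ P *ᵥ D *ᵥ w) i ≈⟨ *ᵥ-congˡ Q (*ᵥ-congˡ M PDw≈Mu) i ⟩
      (Q *ᵥ M *ᵥ M *ᵥ u) i   ≈⟨ *ᵥ-zero Q (M *ᵥ M *ᵥ u) M²u≈0 i ⟩
      0#                     ∎
    ¬¬Dw≈0 : ∀ i → ¬ ¬ ((D *ᵥ w) i ≈ 0#)
    ¬¬Dw≈0 i = ¬¬-map (≈-trans (D-diag-*ᵥ w i)) (x*[x*y]≈0⇒¬¬x*y≈0 (D i i) (w i) (D²w≈0 i))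
    Dw≈0⇒Mu≈0 : (∀ i → (D *ᵥ w) i ≈ 0#) → ∀ i → (M *ᵥ u) i ≈ 0#
    Dw≈0⇒Mu≈0 Dw≈0 i = ≈-trans (≈-sym (PDw≈Mu i)) (*ᵥ-zero P (D *ᵥ w) Dw≈0 i)

  -- Let M be the 0/1 matrix of a decidable relation E in which every vertex i has exactly the two out-neighbours
  -- out₁ i ≢ out₂ i, and let p, q be vertices whose in-arcs from out₁ i and out₂ i are swapped. Then for
  -- u = e_p - e_q, (M u)_i = M_ip - M_iq, so (M² u)_i = (M u)_(out₁ i) + (M u)_(out₂ i) = 0, while M u ≠ 0 as
  -- soon as some i₀ has an arc to p but not to q.
  module _ {n} (E : Fin n → Fin n → Set) (E? : ∀ i j → Dec (E i j)) (M : Mat n)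
           (M-adjacency : ∀ i j → (E i j → M i j ≈ 1#) × (¬ E i j → M i j ≈ 0#)) where

    M-resp-⇔ : ∀ {i j i′ j′} → (E i j ⇔ E i′ j′) → M i j ≈ M i′ j′
    M-resp-⇔ {i} {j} {i′} {j′} E⇔E′ with E? i j
    ... | yes e  = ≈-trans (proj₁ (M-adjacency i j) e) (≈-sym (proj₁ (M-adjacency i′ j′) (Equivalence.to E⇔E′ e)))
    ... | no ¬e  = ≈-trans (proj₂ (M-adjacency i j) ¬e) (≈-sym (proj₂ (M-adjacency i′ j′) (λ e′ → ¬e (Equivalence.from E⇔E′ e′))))

    ¬Diagonalizable-swapped-columns : (p q : Fin n) (out₁ out₂ : Fin n → Fin n) →
      (∀ i → out₁ i ≢ out₂ i) → (∀ i → E i (out₁ i) × E i (out₂ i)) → (∀ i j → E i j → j ≡ out₁ i ⊎ j ≡ out₂ i) →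
      (∀ i → E (out₁ i) p ⇔ E (out₂ i) q) → (∀ i → E (out₁ i) q ⇔ E (out₂ i) p) →
      ∀ i₀ → E i₀ p → ¬ E i₀ q → ¬ Diagonalizable M
    ¬Diagonalizable-swapped-columns p q out₁ out₂ out₁≢out₂ out-arcs only-out swap₁ swap₂ i₀ i₀→p ¬i₀→q diagonalizable =
      diagonalizable-M²u≈0⇒¬¬Mu≈0 M u diagonalizable M²u≈0 (λ Mu≈0 → nontrivial (≈-trans (≈-sym Mu[i₀]≈1) (Mu≈0 i₀)))
      where
      u : Vector n
      u j = IdM j p - IdM j q
      Mu≈ : ∀ i → (M *ᵥ u) i ≈ M i p - M i q
      Mu≈ i = begin
        sum (λ j → M i j * (IdM j p - IdM j q))                ≈⟨ sum-cong-≋ (λ j → x[y-z]≈xy-xz (M i j) (IdM j p) (IdM j q)) ⟩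
        sum (λ j → M i j * IdM j p - M i j * IdM j q)          ≈⟨ ∑-distrib-+ (λ j → M i j * IdM j p) (λ j → - (M i j * IdM j q)) ⟩
        sum (λ j → M i j * IdM j p) + sum (λ j → - (M i j * IdM j q)) ≈⟨ +-congˡ (sum-neg (λ j → M i j * IdM j q)) ⟩
        (M *ᵥ (λ j → IdM j p)) i - (M *ᵥ (λ j → IdM j q)) i  ≈⟨ +-cong (*ᵥ-IdM-column M p i) (-‿cong (*ᵥ-IdM-column M q i)) ⟩
        M i p - M i q                                          ∎
      M²u≈0 : ∀ i → (M *ᵥ M *ᵥ u) i ≈ 0#
      M²u≈0 i = begin
        (M *ᵥ M *ᵥ u) i                                        ≈⟨ sum-pair (λ j → M i j * (M *ᵥ u) j) (out₁ i) (out₂ i) (out₁≢out₂ i) off-out ⟩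
        M i o₁ * (M *ᵥ u) o₁ + M i o₂ * (M *ᵥ u) o₂            ≈⟨ +-cong (≈-trans (*-congʳ (proj₁ (M-adjacency i o₁) (proj₁ (out-arcs i)))) (*-identityˡ _))
                                                                          (≈-trans (*-congʳ (proj₁ (M-adjacency i o₂) (proj₂ (out-arcs i)))) (*-identityˡ _)) ⟩
        (M *ᵥ u) o₁ + (M *ᵥ u) o₂                              ≈⟨ +-cong (Mu≈ o₁) (Mu≈ o₂) ⟩
        (M o₁ p - M o₁ q) + (M o₂ p - M o₂ q)                  ≈⟨ +-congˡ (+-cong (≈-sym (M-resp-⇔ (swap₂ i))) (-‿cong (≈-sym (M-resp-⇔ (swap₁ i))))) ⟩
        (M o₁ p - M o₁ q) + (M o₁ q - M o₁ p)                  ≈⟨ +-congˡ (⁻¹-anti-homo‿- (M o₁ p) (M o₁ q)) ⟨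
        (M o₁ p - M o₁ q) + - (M o₁ p - M o₁ q)                ≈⟨ -‿inverseʳ (M o₁ p - M o₁ q) ⟩
        0#                                                     ∎
        where
        o₁ = out₁ i
        o₂ = out₂ i
        off-out : ∀ j → j ≢ o₁ → j ≢ o₂ → M i j * (M *ᵥ u) j ≈ 0#
        off-out j j≢o₁ j≢o₂ = ≈-trans (*-congʳ (proj₂ (M-adjacency i j) (λ e → [ j≢o₁ , j≢o₂ ]′ (only-out i j e)))) (zeroˡ _)
      Mu[i₀]≈1 : (M *ᵥ u) i₀ ≈ 1#
      Mu[i₀]≈1 = begin
        (M *ᵥ u) i₀           ≈⟨ Mu≈ i₀ ⟩
        M i₀ p - M i₀ q       ≈⟨ +-cong (proj₁ (M-adjacency i₀ p) i₀→p) (-‿cong (proj₂ (M-adjacency i₀ q) ¬i₀→q)) ⟩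
        1# - 0#               ≈⟨ +-congˡ -0#≈0# ⟩
        1# + 0#               ≈⟨ +-identityʳ 1# ⟩
        1#                    ∎

  module _ {A : Set} (V : A → Set) (E : A → A → Set) (l : List A) (l-unique : Unique l)
           (l-enumerates : ∀ x → V x ⇔ x ∈ l) (M : Mat (length l))
           (M-adjacency : ∀ i j → (E (List.lookup l i) (List.lookup l j) → M i j ≈ 1#) ×
                                  (¬ E (List.lookup l i) (List.lookup l j) → M i j ≈ 0#)) where

    ¬Diagonalizable-swapped-in-arcs : (E? : ∀ x y → V x → Dec (E x y)) →
      (out : Bool → ∀ x → V x → A) → (∀ c x vx → V (out c x vx)) → (∀ x vx → out true x vx ≢ out false x vx) →
      (∀ c x vx → E x (out c x vx)) → (∀ x vx y → E x y → y ≡ out true x vx ⊎ y ≡ out false x vx) →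
      (p q x₀ : A) → V p → V q → V x₀ →
      (∀ x vx → E (out true x vx) p ⇔ E (out false x vx) q) → (∀ x vx → E (out true x vx) q ⇔ E (out false x vx) p) →
      E x₀ p → ¬ E x₀ q → ¬ Diagonalizable M
    ¬Diagonalizable-swapped-in-arcs E? out out-V out-distinct out-arc only-out p q x₀ vp vq vx₀ swap₁ swap₂ x₀→p ¬x₀→q =
      ¬Diagonalizable-swapped-columns Eᶠ (λ i j → E? (vertex i) (vertex j) (vertex-V i)) M M-adjacency
        (indexOf p vp) (indexOf q vq) (outᶠ true) (outᶠ false)
        (λ i eq → out-distinct (vertex i) (vertex-V i) (trans (sym (vertex-outᶠ true i)) (trans (cong vertex eq) (vertex-outᶠ false i))))
        (λ i → outᶠ-arc true i , outᶠ-arc false i) only-outᶠ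
        (λ i → at-vertices (vertex-outᶠ true i) (vertex-indexOf p vp) (vertex-outᶠ false i) (vertex-indexOf q vq) (swap₁ (vertex i) (vertex-V i)))
        (λ i → at-vertices (vertex-outᶠ true i) (vertex-indexOf q vq) (vertex-outᶠ false i) (vertex-indexOf p vp) (swap₂ (vertex i) (vertex-V i)))
        (indexOf x₀ vx₀)
        (subst₂ E (sym (vertex-indexOf x₀ vx₀)) (sym (vertex-indexOf p vp)) x₀→p)
        (λ e → ¬x₀→q (subst₂ E (vertex-indexOf x₀ vx₀) (vertex-indexOf q vq) e))
      where
      vertex : Fin (length l) → A
      vertex = List.lookup l
      vertex-V : ∀ i → V (vertex i)
      vertex-V i = Equivalence.from (l-enumerates (vertex i)) (∈-lookup i)
      indexOf : ∀ x → V x → Fin (length l)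
      indexOf x vx = index (Equivalence.to (l-enumerates x) vx)
      vertex-indexOf : ∀ x vx → vertex (indexOf x vx) ≡ x
      vertex-indexOf x vx = sym (lookup-index (Equivalence.to (l-enumerates x) vx))
      Eᶠ : Fin (length l) → Fin (length l) → Set
      Eᶠ i j = E (vertex i) (vertex j)
      outᶠ : Bool → Fin (length l) → Fin (length l)
      outᶠ c i = indexOf (out c (vertex i) (vertex-V i)) (out-V c (vertex i) (vertex-V i))
      vertex-outᶠ : ∀ c i → vertex (outᶠ c i) ≡ out c (vertex i) (vertex-V i)
      vertex-outᶠ c i = vertex-indexOf _ _
      outᶠ-arc : ∀ c i → Eᶠ i (outᶠ c i)
      outᶠ-arc c i = subst (E (vertex i)) (sym (vertex-outᶠ c i)) (out-arc c (vertex i) (vertex-V i))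
      only-outᶠ : ∀ i j → Eᶠ i j → j ≡ outᶠ true i ⊎ j ≡ outᶠ false i
      only-outᶠ i j e = [ (λ eq → inj₁ (lookup-injective l-unique j _ (trans eq (sym (vertex-outᶠ true i)))))
                        , (λ eq → inj₂ (lookup-injective l-unique j _ (trans eq (sym (vertex-outᶠ false i))))) ]′
                        (only-out (vertex i) (vertex-V i) (vertex j) e)
      at-vertices : ∀ {i j i′ j′ x y x′ y′} → vertex i ≡ x → vertex j ≡ y → vertex i′ ≡ x′ → vertex j′ ≡ y′ →
                    E x y ⇔ E x′ y′ → Eᶠ i j ⇔ Eᶠ i′ j′
      at-vertices refl refl refl refl E⇔E′ = E⇔E′

-- The arithmetic of ℕ is opened only here: its names (_+_, _*_, +-comm, …) clash with those of the field
-- operations in LinearAlgebra.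
open import Data.Nat using (_+_; _*_; _∸_; _^_; _≤_; _<?_; z≤n; s≤s)
open import Data.Nat.Properties
open import Data.Nat.Tactic.RingSolver using (solve-∀)

2*n≡n+n : ∀ n → 2 * n ≡ n + n
2*n≡n+n n = cong (n +_) (+-identityʳ n)

bit : Bool → ℕ
bit false = 0
bit true  = 1

halve : ℕ → ℕ × Bool
halve zero          = 0 , false
halve (suc zero)    = 0 , true
halve (suc (suc n)) = suc (proj₁ (halve n)) , proj₂ (halve n)

private
  2*suc+bit : ∀ q b → 2 * suc q + b ≡ suc (suc (2 * q + b))
  2*suc+bit = solve-∀

halve-2*+bit : ∀ q r → halve (2 * q + bit r) ≡ (q , r)
halve-2*+bit zero false = refl
halve-2*+bit zero true  = refl
halve-2*+bit (suc q) r rewrite 2*suc+bit q (bit r) | halve-2*+bit q r = refl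

2*+bit-halve : ∀ j → 2 * proj₁ (halve j) + bit (proj₂ (halve j)) ≡ j
2*+bit-halve zero = refl
2*+bit-halve (suc zero) = refl
2*+bit-halve (suc (suc j)) =
  trans (2*suc+bit (proj₁ (halve j)) _) (cong (λ n → suc (suc n)) (2*+bit-halve j))

2*+bit-injective : ∀ {q r q′ r′} → 2 * q + bit r ≡ 2 * q′ + bit r′ → q ≡ q′ × r ≡ r′
2*+bit-injective {q} {r} {q′} {r′} eq
  with trans (sym (halve-2*+bit q r)) (trans (cong halve eq) (halve-2*+bit q′ r′))
... | refl = refl , refl

2*+bit-≢ˡ : ∀ {q r q′ r′} → q ≢ q′ → 2 * q + bit r ≢ 2 * q′ + bit r′
2*+bit-≢ˡ {q} {r} {q′} {r′} q≢q′ eq = q≢q′ (proj₁ (2*+bit-injective {q} {r} {q′} {r′} eq))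

2*+bit-≢ʳ : ∀ {q r q′ r′} → r ≢ r′ → 2 * q + bit r ≢ 2 * q′ + bit r′
2*+bit-≢ʳ {q} {r} {q′} {r′} r≢r′ eq = r≢r′ (proj₂ (2*+bit-injective {q} {r} {q′} {r′} eq))

2*+bit-mono-< : ∀ {q n} r → q < n → 2 * q + bit r < 2 * n
2*+bit-mono-< {q} {n} r q<n = begin-strict
  2 * q + bit r <⟨ +-monoʳ-< (2 * q) (bit<2 r) ⟩
  2 * q + 2     ≡⟨ 2*suc q ⟨
  2 * suc q     ≤⟨ *-monoʳ-≤ 2 q<n ⟩
  2 * n         ∎
  where
  open ≤-Reasoning
  2*suc : ∀ q → 2 * suc q ≡ 2 * q + 2
  2*suc = solve-∀
  bit<2 : ∀ r → bit r < 2
  bit<2 false = s≤s z≤n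
  bit<2 true  = s≤s (s≤s z≤n)

2*+bit-cancel-< : ∀ {q n} r → 2 * q + bit r < 2 * n → q < n
2*+bit-cancel-< {q} {n} r lt with q <? n
... | yes q<n = q<n
... | no  q≮n = ⊥-elim (<⇒≱ lt (≤-trans (*-monoʳ-≤ 2 (≮⇒≥ q≮n)) (m≤m+n (2 * q) (bit r))))

by-halves : ∀ {p} (P : ℕ → Set p) {n} → (∀ q r → q < n → P (2 * q + bit r)) → ∀ j → j < 2 * n → P j
by-halves P {n} P-halves j j<2n =
  subst P (2*+bit-halve j) (P-halves q r (2*+bit-cancel-< r (subst (_< 2 * n) (sym (2*+bit-halve j)) j<2n)))
  where
  q = proj₁ (halve j)
  r = proj₂ (halve j)

toℕ-finOr : ∀ {n} (d : Fin n) m → m < n → toℕ (finOr d m) ≡ m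
toℕ-finOr {n} d m m<n with m <? n
... | yes m<n′ = Finₚ.toℕ-fromℕ< m<n′
... | no  m≮n  = ⊥-elim (m≮n m<n)

finOr-irrelevant : ∀ {n} (d d′ : Fin n) m → m < n → finOr d m ≡ finOr d′ m
finOr-irrelevant d d′ m m<n = Finₚ.toℕ-injective (trans (toℕ-finOr d m m<n) (sym (toℕ-finOr d′ m m<n)))

finOr-toℕ : ∀ {n} (i : Fin n) → finOr i (toℕ i) ≡ i
finOr-toℕ i = Finₚ.toℕ-injective (toℕ-finOr i (toℕ i) (Finₚ.toℕ<n i))

MapsInto : ℕ → (ℕ → ℕ) → Set
MapsInto n f = ∀ j → j < n → f j < n

module _ {n : ℕ} where

  ·-assoc : (p q r : Perm n) → (p · q) · r ≡ p · (q · r)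
  ·-assoc p q r = tabulate-cong λ i →
    trans (cong (Vec.lookup r) (lookup∘tabulate _ i)) (sym (lookup∘tabulate _ (Vec.lookup p i)))

  ·-identityˡ : (p : Perm n) → idP · p ≡ p
  ·-identityˡ p = trans (tabulate-cong λ i → cong (Vec.lookup p) (lookup∘tabulate _ i)) (tabulate∘lookup p)

  ·-identityʳ : (p : Perm n) → p · idP ≡ p
  ·-identityʳ p = trans (tabulate-cong λ i → lookup∘tabulate _ (Vec.lookup p i)) (tabulate∘lookup p)

  ·-inverse-unique : ∀ (x y z : Perm n) → y · x ≡ idP → x · z ≡ idP → z ≡ y
  ·-inverse-unique x y z y·x≡id x·z≡id = begin
    z            ≡⟨ ·-identityˡ z ⟨
    idP · z      ≡⟨ cong (_· z) y·x≡id ⟨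
    (y · x) · z  ≡⟨ ·-assoc y x z ⟩
    y · (x · z)  ≡⟨ cong (y ·_) x·z≡id ⟩
    y · idP      ≡⟨ ·-identityʳ y ⟩
    y            ∎
    where open ≡-Reasoning

  ·-inverseʳ : ∀ (x y z : Perm n) → y · x ≡ idP → z · y ≡ idP → x · y ≡ idP
  ·-inverseʳ x y z y·x≡id z·y≡id = subst (λ w → w · y ≡ idP) (sym (·-inverse-unique y z x z·y≡id y·x≡id)) z·y≡id

  ·-cancelʳ : ∀ (z y x : Perm n) → y · x ≡ idP → (z · y) · x ≡ z
  ·-cancelʳ z y x y·x≡id = trans (·-assoc z y x) (trans (cong (z ·_) y·x≡id) (·-identityʳ z))

  mkPerm-cong : ∀ (f g : ℕ → ℕ) → (∀ j → j < n → f j ≡ g j) → mkPerm n f ≡ mkPerm n g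
  mkPerm-cong f g f≗g = tabulate-cong λ i → cong (finOr i) (f≗g (toℕ i) (Finₚ.toℕ<n i))

  mkPerm-· : ∀ (f g : ℕ → ℕ) → MapsInto n f → MapsInto n g →
             mkPerm n f · mkPerm n g ≡ mkPerm n (λ j → g (f j))
  mkPerm-· f g f< g< = tabulate-cong λ i →
    let j = toℕ i ; d = finOr i (f j) ; fj<n = f< j (Finₚ.toℕ<n i) in
    trans (cong (Vec.lookup (mkPerm n g)) (lookup∘tabulate _ i))
    (trans (lookup∘tabulate _ d)
    (trans (cong (λ x → finOr d (g x)) (toℕ-finOr i (f j) fj<n))
           (finOr-irrelevant d i (g (f j)) (g< (f j) fj<n))))

  idP≡mkPerm-id : idP ≡ mkPerm n (λ j → j)
  idP≡mkPerm-id = tabulate-cong λ i → sym (finOr-toℕ i)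

  toℕ-lookup-mkPerm : ∀ (f : ℕ → ℕ) (i : Fin n) → f (toℕ i) < n →
                      toℕ (Vec.lookup (mkPerm n f) i) ≡ f (toℕ i)
  toℕ-lookup-mkPerm f i lt = trans (cong toℕ (lookup∘tabulate _ i)) (toℕ-finOr i _ lt)

at : ∀ {m} → Vec Bool m → ℕ → Bool
at []       _       = false
at (x ∷ xs) zero    = x
at (x ∷ xs) (suc i) = at xs i

tabulateℕ : ∀ m → (ℕ → Bool) → Vec Bool m
tabulateℕ zero    f = []
tabulateℕ (suc m) f = f 0 ∷ tabulateℕ m (λ i → f (suc i))

at-tabulateℕ : ∀ m f i → i < m → at (tabulateℕ m f) i ≡ f i
at-tabulateℕ (suc m) f zero    _         = refl
at-tabulateℕ (suc m) f (suc i) (s≤s i<m) = at-tabulateℕ m (λ i → f (suc i)) i i<m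

at-ext : ∀ {m} (v w : Vec Bool m) → (∀ i → i < m → at v i ≡ at w i) → v ≡ w
at-ext []       []       _   = refl
at-ext (x ∷ v) (y ∷ w) v≗w =
  cong₂ _∷_ (v≗w 0 (s≤s z≤n)) (at-ext v w (λ i i<m → v≗w (suc i) (s≤s i<m)))

Unique-mapOn⁺ : ∀ {A B : Set} {P : A → Set} (f : A → B) → (∀ {x y} → P x → P y → f x ≡ f y → x ≡ y) →
                ∀ {xs} → All P xs → Unique xs → Unique (List.map f xs)
Unique-mapOn⁺ f inj {List.[]}     _          _            = []
Unique-mapOn⁺ f inj {x List.∷ xs} (px ∷ pxs) (x∉xs ∷ uxs) = fx∉fxs pxs x∉xs ∷ Unique-mapOn⁺ f inj pxs uxs
  where
  fx∉fxs : ∀ {ys} → All _ ys → All (λ y → x ≢ y) ys → All (λ y → f x ≢ y) (List.map f ys)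
  fx∉fxs []         []           = []
  fx∉fxs (py ∷ pys) (x≢y ∷ x≢ys) = (λ fx≡fy → x≢y (inj px py fx≡fy)) ∷ fx∉fxs pys x≢ys

bitVecs : ∀ m → List (Vec Bool m)
bitVecs zero    = List.[ [] ]
bitVecs (suc m) = List.map (true ∷_) (bitVecs m) ++ List.map (false ∷_) (bitVecs m)

length-bitVecs : ∀ m → length (bitVecs m) ≡ 2 ^ m
length-bitVecs zero = refl
length-bitVecs (suc m) = begin
  length (List.map (true ∷_) (bitVecs m) ++ List.map (false ∷_) (bitVecs m))
    ≡⟨ length-++ (List.map (true ∷_) (bitVecs m)) ⟩
  length (List.map (true ∷_) (bitVecs m)) + length (List.map (false ∷_) (bitVecs m))
    ≡⟨ cong₂ _+_ (length-map (true ∷_) (bitVecs m)) (length-map (false ∷_) (bitVecs m)) ⟩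
  length (bitVecs m) + length (bitVecs m)
    ≡⟨ cong (λ n → n + n) (length-bitVecs m) ⟩
  2 ^ m + 2 ^ m
    ≡⟨ cong (2 ^ m +_) (+-identityʳ (2 ^ m)) ⟨
  2 ^ suc m ∎
  where open ≡-Reasoning

bitVecs-unique : ∀ m → Unique (bitVecs m)
bitVecs-unique zero    = [] ∷ []
bitVecs-unique (suc m) =
  Unique.++⁺ (Unique.map⁺ ∷-injectiveʳ (bitVecs-unique m)) (Unique.map⁺ ∷-injectiveʳ (bitVecs-unique m)) disjoint
  where
  ∷-injectiveʳ : ∀ {b} {v w : Vec Bool m} → b ∷ v ≡ b ∷ w → v ≡ w
  ∷-injectiveʳ refl = refl
  disjoint : ∀ {v} → ¬ (v ∈ List.map (true ∷_) (bitVecs m) × v ∈ List.map (false ∷_) (bitVecs m))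
  disjoint (v∈ , v∈′) with ∈-map⁻ (true ∷_) v∈ | ∈-map⁻ (false ∷_) v∈′
  ... | _ , _ , refl | _ , _ , ()

∈-bitVecs : ∀ m (v : Vec Bool m) → v ∈ bitVecs m
∈-bitVecs zero    []         = here refl
∈-bitVecs (suc m) (true ∷ v)  = ∈-++⁺ˡ (∈-map⁺ (true ∷_) (∈-bitVecs m v))
∈-bitVecs (suc m) (false ∷ v) = ∈-++⁺ʳ (List.map (true ∷_) (bitVecs m)) (∈-map⁺ (false ∷_) (∈-bitVecs m v))

module _ {A : Set} {V : A → Set} {E : A → A → Set} where
  open Automorphism

  Automorphism-∘ : Automorphism V E → Automorphism V E → Automorphism V E
  Automorphism-∘ ψ φ = record
    { f     = λ x → f ψ (f φ x)
    ; g     = λ x → g φ (g ψ x)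
    ; f-V   = λ x vx → f-V ψ _ (f-V φ x vx)
    ; g-V   = λ x vx → g-V φ _ (g-V ψ x vx)
    ; gf    = λ x vx → trans (cong (g φ) (gf ψ _ (f-V φ x vx))) (gf φ x vx)
    ; fg    = λ x vx → trans (cong (f ψ) (fg φ _ (g-V ψ x vx))) (fg ψ x vx)
    ; f-arc = λ x y vx vy →
        let φ-arc = f-arc φ x y vx vy
            ψ-arc = f-arc ψ _ _ (f-V φ x vx) (f-V φ y vy) in
        mk⇔ (λ e → Equivalence.to ψ-arc (Equivalence.to φ-arc e))
            (λ e → Equivalence.from φ-arc (Equivalence.from ψ-arc e))
    }

  module _ (E⇒V : ∀ {x y} → E x y → V x × V y) where

    IsArcSeq-map : (φ : Automorphism V E) → ∀ {k} {α : Vec A (suc k)} →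
                   IsArcSeq V E α → IsArcSeq V E (Vec.map (f φ) α)
    IsArcSeq-map φ (one vv)      = one (f-V φ _ vv)
    IsArcSeq-map φ (cons e arcs) =
      cons (Equivalence.to (f-arc φ _ _ (proj₁ (E⇒V e)) (proj₂ (E⇒V e))) e) (IsArcSeq-map φ arcs)

    IsArcSeq-head : ∀ {k} {α : Vec A (suc k)} → IsArcSeq V E α → V (Vec.head α)
    IsArcSeq-head (one vv)   = vv
    IsArcSeq-head (cons e _) = proj₁ (E⇒V e)

    IsArcSeq-map-cong : ∀ {k} {α : Vec A (suc k)} → IsArcSeq V E α → (h h′ : A → A) →
                        (∀ x → V x → h x ≡ h′ x) → Vec.map h α ≡ Vec.map h′ α
    IsArcSeq-map-cong (one vv)      h h′ h≗h′ = cong (_∷ []) (h≗h′ _ vv)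
    IsArcSeq-map-cong (cons e arcs) h h′ h≗h′ = cong₂ _∷_ (h≗h′ _ (proj₁ (E⇒V e))) (IsArcSeq-map-cong arcs h h′ h≗h′)

module Model (t : ℕ) where

  s : ℕ
  s = suc (suc t)

  2s : ℕ
  2s = 2 * s

  s-1 : ℕ
  s-1 = suc t

  2s-1 : ℕ
  2s-1 = suc (2 * suc t)

  2s≡1+2s-1 : 2s ≡ suc 2s-1
  2s≡1+2s-1 = lemma t
    where
    lemma : ∀ t → 2 * suc (suc t) ≡ suc (suc (2 * suc t))
    lemma = solve-∀

  4s≡2*2s : 4 * s ≡ 2 * 2s
  4s≡2*2s = lemma t
    where
    lemma : ∀ t → 4 * suc (suc t) ≡ 2 * (2 * suc (suc t))
    lemma = solve-∀

  2s≡s+s : 2s ≡ s + s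
  2s≡s+s = 2*n≡n+n s

  2s-1≡s+s-1 : 2s-1 ≡ s + s-1
  2s-1≡s+s-1 = lemma t
    where
    lemma : ∀ t → suc (2 * suc t) ≡ suc (suc t) + suc t
    lemma = solve-∀

  2s-1<2s : 2s-1 < 2s
  2s-1<2s = subst (2s-1 <_) (sym 2s≡1+2s-1) (n<1+n 2s-1)

  s<2s : s < 2s
  s<2s = subst (s <_) (sym 2s≡s+s) (m<m+n s {s} (s≤s z≤n))

  s≤2s : s ≤ 2s
  s≤2s = <⇒≤ s<2s

  s-1≢2s-1 : s-1 ≢ 2s-1
  s-1≢2s-1 eq = <-irrefl eq (subst (s-1 <_) (sym 2s-1≡s+s-1) (m<n+m s-1 {s} (s≤s z≤n)))

  -- The 4s points are j = 2 q + bit r with column q < 2s and row r.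

  point<4s : ∀ q c → q < 2s → 2 * q + bit c < 4 * s
  point<4s q c q<2s = subst (2 * q + bit c <_) (sym 4s≡2*2s) (2*+bit-mono-< c q<2s)

  by-points : ∀ {p} (P : ℕ → Set p) → (∀ q r → q < 2s → P (2 * q + bit r)) → ∀ j → j < 4 * s → P j
  by-points P P-points j j<4s = by-halves P P-points j (subst (j <_) 4s≡2*2s j<4s)

  -- (k , v) encodes the permutation sending the point in column q and row r to column q + k (mod 2s)
  -- and row r + v_(q mod s), the row being flipped once more when q + k wraps around.
  Code : Set
  Code = ℕ × Vec Bool s

  Valid : Code → Set
  Valid (k , _) = k < 2s

  bitAt : Vec Bool s → ℕ → Bool
  bitAt v q = if q <ᵇ s then at v q else at v (q ∸ s)

  bitAt-lo : ∀ v q → q < s → bitAt v q ≡ at v q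
  bitAt-lo v q q<s = if-true (<ᵇ-true q<s)

  bitAt-hi : ∀ v q → ¬ q < s → bitAt v q ≡ at v (q ∸ s)
  bitAt-hi v q q≮s = if-false (<ᵇ-false q≮s)

  q∸s<s : ∀ q → q < 2s → ¬ q < s → q ∸ s < s
  q∸s<s q q<2s q≮s = subst (q ∸ s <_) (m+n∸m≡n s s) (∸-monoˡ-< (subst (q <_) 2s≡s+s q<2s) (≮⇒≥ q≮s))

  wrap : ℕ → Bool → ℕ
  wrap x c = if x <ᵇ 2s then 2 * x + bit c else 2 * (x ∸ 2s) + bit (not c)

  wrap-lo : ∀ x c → x < 2s → wrap x c ≡ 2 * x + bit c
  wrap-lo x c x<2s = if-true (<ᵇ-true x<2s)

  wrap-hi : ∀ x c → ¬ x < 2s → wrap x c ≡ 2 * (x ∸ 2s) + bit (not c)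
  wrap-hi x c x≮2s = if-false (<ᵇ-false x≮2s)

  wrap-+2s : ∀ q c → wrap (q + 2s) c ≡ 2 * q + bit (not c)
  wrap-+2s q c = trans (wrap-hi (q + 2s) c (λ lt → <-irrefl refl (≤-<-trans (m≤n+m 2s q) lt)))
                       (cong (λ x → 2 * x + bit (not c)) (m+n∸n≡m q 2s))

  wrap<4s : ∀ x c → x < 2 * 2s → wrap x c < 4 * s
  wrap<4s x c x<4s with x <? 2s
  ... | yes x<2s rewrite wrap-lo x c x<2s = point<4s x c x<2s
  ... | no  x≮2s rewrite wrap-hi x c x≮2s = point<4s (x ∸ 2s) (not c)
        (subst (x ∸ 2s <_) (m+n∸m≡n 2s 2s) (∸-monoˡ-< (subst (x <_) (2*n≡n+n 2s) x<4s) (≮⇒≥ x≮2s)))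

  action : Code → ℕ → ℕ
  action (k , v) j = wrap (q + k) (r xor bitAt v q)
    where
    q = proj₁ (halve j)
    r = proj₂ (halve j)

  action-point : ∀ k v q r → action (k , v) (2 * q + bit r) ≡ wrap (q + k) (r xor bitAt v q)
  action-point k v q r rewrite halve-2*+bit q r = refl

  action-mapsInto : ∀ m → Valid m → MapsInto (4 * s) (action m)
  action-mapsInto (k , v) k<2s = by-points (λ j → action (k , v) j < 4 * s) λ q r q<2s →
    subst (_< 4 * s) (sym (action-point k v q r))
      (wrap<4s (q + k) _ (subst (q + k <_) (sym (2*n≡n+n 2s)) (+-mono-< q<2s k<2s)))

  opaque
    encode : Code → Perm (4 * s)
    encode m = mkPerm (4 * s) (action m)

    encode-def : ∀ m → encode m ≡ mkPerm (4 * s) (action m)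
    encode-def m = refl

  mkPerm·encode : ∀ f m m′ → MapsInto (4 * s) f → Valid m →
                  (∀ q r → q < 2s → action m (f (2 * q + bit r)) ≡ action m′ (2 * q + bit r)) →
                  mkPerm (4 * s) f · encode m ≡ encode m′
  mkPerm·encode f m m′ f< m-valid f-action = begin
    mkPerm (4 * s) f · encode m                ≡⟨ cong (mkPerm (4 * s) f ·_) (encode-def m) ⟩
    mkPerm (4 * s) f · mkPerm (4 * s) (action m) ≡⟨ mkPerm-· f (action m) f< (action-mapsInto m m-valid) ⟩
    mkPerm (4 * s) (λ j → action m (f j))       ≡⟨ mkPerm-cong _ (action m′) (by-points (λ j → action m (f j) ≡ action m′ j) f-action) ⟩
    mkPerm (4 * s) (action m′)                  ≡⟨ encode-def m′ ⟨
    encode m′                                   ∎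
    where open ≡-Reasoning

  rotate : Vec Bool s → Vec Bool s
  rotate v = tabulateℕ s (λ i → if suc i <ᵇ s then at v (suc i) else at v 0)

  complement : Vec Bool s → Vec Bool s
  complement v = tabulateℕ s (λ i → not (at v i))

  flipAt : ℕ → Vec Bool s → Vec Bool s
  flipAt p v = tabulateℕ s (λ i → at v i xor (i ≡ᵇ p))

  at-rotate : ∀ v i → suc i < s → at (rotate v) i ≡ at v (suc i)
  at-rotate v i 1+i<s = trans (at-tabulateℕ s (λ i → if suc i <ᵇ s then at v (suc i) else at v 0) i (<-trans (n<1+n i) 1+i<s)) (if-true (<ᵇ-true 1+i<s))

  at-rotate-last : ∀ v → at (rotate v) s-1 ≡ at v 0
  at-rotate-last v = trans (at-tabulateℕ s (λ i → if suc i <ᵇ s then at v (suc i) else at v 0) s-1 (n<1+n s-1)) (if-false (<ᵇ-false {s} {s} (<-irrefl refl)))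

  at-complement : ∀ v i → i < s → at (complement v) i ≡ not (at v i)
  at-complement v = at-tabulateℕ s (λ i → not (at v i))

  at-flipAt : ∀ p v i → i < s → at (flipAt p v) i ≡ at v i xor (i ≡ᵇ p)
  at-flipAt p v = at-tabulateℕ s (λ i → at v i xor (i ≡ᵇ p))

  bitAt-rotate : ∀ v q → suc q < 2s → bitAt (rotate v) q ≡ bitAt v (suc q)
  bitAt-rotate v q 1+q<2s with suc q <? s | suc q ≟ s
  ... | yes 1+q<s | _ =
    trans (bitAt-lo (rotate v) q (<-trans (n<1+n q) 1+q<s)) (trans (at-rotate v q 1+q<s) (sym (bitAt-lo v (suc q) 1+q<s)))
  ... | no 1+q≮s | yes refl =
    trans (bitAt-lo (rotate v) s-1 (n<1+n s-1)) (trans (at-rotate-last v) (sym (trans (bitAt-hi v s 1+q≮s) (cong (at v) (n∸n≡0 s)))))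
  ... | no 1+q≮s | no 1+q≢s =
    trans (bitAt-hi (rotate v) q (λ q<s → 1+q≢s (≤-antisym q<s (≮⇒≥ 1+q≮s))))
    (trans (at-rotate v (q ∸ s) (subst (_< s) 1+q∸s≡ (q∸s<s (suc q) 1+q<2s 1+q≮s)))
    (trans (cong (at v) (sym 1+q∸s≡)) (sym (bitAt-hi v (suc q) 1+q≮s))))
    where
    1+q∸s≡ : suc q ∸ s ≡ suc (q ∸ s)
    1+q∸s≡ = +-∸-assoc 1 (≤-pred (≤∧≢⇒< (≮⇒≥ 1+q≮s) (λ eq → 1+q≢s (sym eq))))

  bitAt-rotate-last : ∀ v → bitAt (rotate v) 2s-1 ≡ at v 0
  bitAt-rotate-last v =
    trans (bitAt-hi (rotate v) 2s-1 (λ lt → <-irrefl refl (≤-trans lt (subst (s ≤_) (sym 2s-1≡s+s-1) (m≤m+n s s-1)))))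
    (trans (cong (at (rotate v)) (trans (cong (_∸ s) 2s-1≡s+s-1) (m+n∸m≡n s s-1))) (at-rotate-last v))

  bitAt-complement : ∀ v q → q < 2s → bitAt (complement v) q ≡ not (bitAt v q)
  bitAt-complement v q q<2s with q <? s
  ... | yes q<s rewrite bitAt-lo (complement v) q q<s | bitAt-lo v q q<s = at-complement v q q<s
  ... | no  q≮s rewrite bitAt-hi (complement v) q q≮s | bitAt-hi v q q≮s = at-complement v (q ∸ s) (q∸s<s q q<2s q≮s)

  -- The generator b moves every column one step, the last column returning to column 0 with its rows swapped.

  bFun-inner : ∀ q r → suc q < 2s → bFun s (2 * q + bit r) ≡ 2 * suc q + bit r
  bFun-inner q r 1+q<2s =
    trans (if-true (<ᵇ-true (subst (_< 4 * s) (sym (+2≡ q (bit r))) (point<4s (suc q) r 1+q<2s)))) (+2≡ q (bit r))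
    where
    +2≡ : ∀ q b → 2 * q + b + 2 ≡ 2 * suc q + b
    +2≡ = solve-∀

  bFun-last : ∀ r → bFun s (2 * 2s-1 + bit r) ≡ bit (not r)
  bFun-last r = trans (if-false (<ᵇ-false (λ lt → <⇒≱ lt 4s≤))) (last-row r)
    where
    4s+b≡ : ∀ t b → 4 * suc (suc t) + b ≡ 2 * suc (2 * suc t) + b + 2
    4s+b≡ = solve-∀
    4s≤ : 4 * s ≤ 2 * 2s-1 + bit r + 2
    4s≤ = subst (4 * s ≤_) (4s+b≡ t (bit r)) (m≤m+n (4 * s) (bit r))
    4s≡ : ∀ t → 4 * suc (suc t) ≡ suc (suc (2 * suc (2 * suc t) + 0))
    4s≡ = solve-∀
    4s-2≡ : 4 * s ∸ 2 ≡ 2 * 2s-1 + bit false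
    4s-2≡ = cong (_∸ 2) (4s≡ t)
    last-row : ∀ r → (if 2 * 2s-1 + bit r ≡ᵇ 4 * s ∸ 2 then 1 else 0) ≡ bit (not r)
    last-row false = if-true (≡ᵇ-true (sym 4s-2≡))
    last-row true  = if-false (≡ᵇ-false {2 * 2s-1 + bit true} {4 * s ∸ 2} (λ eq → true≢false
                       (proj₂ (2*+bit-injective {2s-1} {true} {2s-1} {false} (trans eq 4s-2≡)))))
      where
      true≢false : true ≢ false
      true≢false ()

  bFun-mapsInto : MapsInto (4 * s) (bFun s)
  bFun-mapsInto = by-points (λ j → bFun s j < 4 * s) bFun-point<4s
    where
    bFun-point<4s : ∀ q r → q < 2s → bFun s (2 * q + bit r) < 4 * s
    bFun-point<4s q r q<2s with m≤n⇒m<n∨m≡n q<2s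
    ... | inj₁ 1+q<2s rewrite bFun-inner q r 1+q<2s = point<4s (suc q) r 1+q<2s
    ... | inj₂ 1+q≡2s with suc-injective (trans 1+q≡2s 2s≡1+2s-1)
    ...   | refl rewrite bFun-last r = point<4s 0 (not r) (s≤s z≤n)

  mulB : Code → Code
  mulB (k , v) = if suc k <ᵇ 2s then (suc k , rotate v) else (0 , complement (rotate v))

  mulB-inner : ∀ k v → suc k < 2s → mulB (k , v) ≡ (suc k , rotate v)
  mulB-inner k v 1+k<2s = if-true (<ᵇ-true 1+k<2s)

  mulB-wrap : ∀ k v → suc k ≡ 2s → mulB (k , v) ≡ (0 , complement (rotate v))
  mulB-wrap k v 1+k≡2s = if-false (<ᵇ-false (<-irrefl 1+k≡2s))

  mulB-valid : ∀ m → Valid m → Valid (mulB m)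
  mulB-valid (k , v) k<2s with m≤n⇒m<n∨m≡n k<2s
  ... | inj₁ 1+k<2s rewrite mulB-inner k v 1+k<2s = 1+k<2s
  ... | inj₂ 1+k≡2s rewrite mulB-wrap k v 1+k≡2s = subst (0 <_) 1+k≡2s (s≤s z≤n)

  -- Both sides are the point wrap (q + k + 1) (r xor v_(q+1 mod s)); when the column or the shift wraps
  -- around, a complemented bit and an extra flip cancel.
  b-action : ∀ k v → k < 2s → ∀ q r → q < 2s → action (k , v) (bFun s (2 * q + bit r)) ≡ action (mulB (k , v)) (2 * q + bit r)
  b-action k v k<2s q r q<2s with m≤n⇒m<n∨m≡n q<2s
  ... | inj₁ 1+q<2s = inner (m≤n⇒m<n∨m≡n k<2s)
    where
    inner : suc k < 2s ⊎ suc k ≡ 2s → action (k , v) (bFun s (2 * q + bit r)) ≡ action (mulB (k , v)) (2 * q + bit r)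
    inner (inj₁ 1+k<2s) rewrite bFun-inner q r 1+q<2s | mulB-inner k v 1+k<2s | action-point k v (suc q) r
                              | action-point (suc k) (rotate v) q r | +-suc q k | bitAt-rotate v q 1+q<2s = refl
    inner (inj₂ 1+k≡2s) rewrite bFun-inner q r 1+q<2s | mulB-wrap k v 1+k≡2s | action-point k v (suc q) r
                              | action-point 0 (complement (rotate v)) q r = begin
      wrap (suc q + k) (r xor bitAt v (suc q))         ≡⟨ cong (λ x → wrap x (r xor bitAt v (suc q))) (trans (sym (+-suc q k)) (cong (q +_) 1+k≡2s)) ⟩
      wrap (q + 2s) (r xor bitAt v (suc q))            ≡⟨ wrap-+2s q _ ⟩
      2 * q + bit (not (r xor bitAt v (suc q)))        ≡⟨ cong₂ (λ x c → 2 * x + bit c) (sym (+-identityʳ q)) (not-distribʳ-xor r _) ⟩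
      2 * (q + 0) + bit (r xor not (bitAt v (suc q)))  ≡⟨ wrap-lo (q + 0) _ (subst (_< 2s) (sym (+-identityʳ q)) (<-trans (n<1+n q) 1+q<2s)) ⟨
      wrap (q + 0) (r xor not (bitAt v (suc q)))       ≡⟨ cong (λ c → wrap (q + 0) (r xor c)) (trans (cong not (sym (bitAt-rotate v q 1+q<2s)))
                                                            (sym (bitAt-complement (rotate v) q (<-trans (n<1+n q) 1+q<2s)))) ⟩
      wrap (q + 0) (r xor bitAt (complement (rotate v)) q) ∎
      where open ≡-Reasoning
  ... | inj₂ 1+q≡2s with suc-injective (trans 1+q≡2s 2s≡1+2s-1)
  ...   | refl rewrite bFun-last r | action-point k v 0 (not r) | wrap-lo k (not r xor at v 0) k<2s = last (m≤n⇒m<n∨m≡n k<2s)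
    where
    last : suc k < 2s ⊎ suc k ≡ 2s → 2 * k + bit (not r xor at v 0) ≡ action (mulB (k , v)) (2 * 2s-1 + bit r)
    last (inj₁ 1+k<2s) rewrite mulB-inner k v 1+k<2s | action-point (suc k) (rotate v) 2s-1 r | bitAt-rotate-last v = begin
      2 * k + bit (not r xor at v 0)      ≡⟨ cong (λ c → 2 * k + bit c) (not-distribˡ-xor r (at v 0)) ⟨
      2 * k + bit (not (r xor at v 0))    ≡⟨ wrap-+2s k _ ⟨
      wrap (k + 2s) (r xor at v 0)        ≡⟨ cong (λ x → wrap x (r xor at v 0)) (trans (cong (k +_) 2s≡1+2s-1) (trans (+-suc k 2s-1) (cong suc (+-comm k 2s-1)))) ⟩
      wrap (suc (2s-1 + k)) (r xor at v 0) ≡⟨ cong (λ x → wrap x (r xor at v 0)) (+-suc 2s-1 k) ⟨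
      wrap (2s-1 + suc k) (r xor at v 0)  ∎
      where open ≡-Reasoning
    last (inj₂ 1+k≡2s) with suc-injective (trans 1+k≡2s 2s≡1+2s-1)
    ... | refl rewrite mulB-wrap 2s-1 v 1+k≡2s | action-point 0 (complement (rotate v)) 2s-1 r = begin
      2 * 2s-1 + bit (not r xor at v 0)        ≡⟨ cong₂ (λ x c → 2 * x + bit c) (sym (+-identityʳ 2s-1)) (xor-swap-not r (at v 0)) ⟩
      2 * (2s-1 + 0) + bit (r xor not (at v 0)) ≡⟨ wrap-lo (2s-1 + 0) _ (subst (_< 2s) (sym (+-identityʳ 2s-1)) 2s-1<2s) ⟨
      wrap (2s-1 + 0) (r xor not (at v 0))      ≡⟨ cong (λ c → wrap (2s-1 + 0) (r xor c))
                                                     (trans (cong not (sym (bitAt-rotate-last v))) (sym (bitAt-complement (rotate v) 2s-1 2s-1<2s))) ⟩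
      wrap (2s-1 + 0) (r xor bitAt (complement (rotate v)) 2s-1) ∎
      where
      open ≡-Reasoning
      xor-swap-not : ∀ a b → not a xor b ≡ a xor not b
      xor-swap-not a b = trans (sym (not-distribˡ-xor a b)) (not-distribʳ-xor a b)

  b·encode : ∀ m → Valid m → b s · encode m ≡ encode (mulB m)
  b·encode (k , v) k<2s = mkPerm·encode (bFun s) (k , v) (mulB (k , v)) bFun-mapsInto k<2s (b-action k v k<2s)

  -- The generator a swaps the two rows of the columns s - 1 and 2s - 1.

  swap₂ : ℕ → ℕ → ℕ → ℕ → ℕ → ℕ
  swap₂ x y u w j = if j ≡ᵇ x then y else if j ≡ᵇ y then x else if j ≡ᵇ u then w else if j ≡ᵇ w then u else j

  swapRows : ℕ → ℕ → ℕ → ℕ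
  swapRows a c = swap₂ (2 * a + 0) (2 * a + 1) (2 * c + 0) (2 * c + 1)

  swap-own-row : ∀ q r (j : ℕ) →
    (if 2 * q + bit r ≡ᵇ 2 * q + 0 then 2 * q + 1 else if 2 * q + bit r ≡ᵇ 2 * q + 1 then 2 * q + 0 else j)
    ≡ 2 * q + bit (r xor true)
  swap-own-row q false j rewrite ≡ᵇ-true {2 * q + 0} refl = refl
  swap-own-row q true  j rewrite ≡ᵇ-false (2*+bit-≢ʳ {q} {true} {q} {false} λ ()) | ≡ᵇ-true {2 * q + 1} refl = refl

  swapRows-point : ∀ a c q r → a ≢ c → swapRows a c (2 * q + bit r) ≡ 2 * q + bit (r xor ((q ≡ᵇ a) ∨ (q ≡ᵇ c)))
  swapRows-point a c q r a≢c with q ≟ a | q ≟ c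
  ... | yes refl | yes refl = ⊥-elim (a≢c refl)
  ... | yes refl | no _     rewrite ≡ᵇ-true {q} refl = swap-own-row q r _
  ... | no q≢a   | yes refl rewrite ≡ᵇ-false q≢a | ≡ᵇ-true {q} refl
                                  | ≡ᵇ-false (2*+bit-≢ˡ {q} {r} {a} {false} q≢a) | ≡ᵇ-false (2*+bit-≢ˡ {q} {r} {a} {true} q≢a)
                                  = swap-own-row q r _
  ... | no q≢a   | no q≢c   rewrite ≡ᵇ-false q≢a | ≡ᵇ-false q≢c
                                  | ≡ᵇ-false (2*+bit-≢ˡ {q} {r} {a} {false} q≢a) | ≡ᵇ-false (2*+bit-≢ˡ {q} {r} {a} {true} q≢a)
                                  | ≡ᵇ-false (2*+bit-≢ˡ {q} {r} {c} {false} q≢c) | ≡ᵇ-false (2*+bit-≢ˡ {q} {r} {c} {true} q≢c)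
                                  | xor-identityʳ r = refl

  aFun≡swapRows : ∀ j → aFun s j ≡ swapRows s-1 2s-1 j
  aFun≡swapRows j = cong₂ (λ xy uw → swap₂ (proj₁ xy) (proj₂ xy) (proj₁ uw) (proj₂ uw) j)
    (cong₂ _,_ (cong (_∸ 2) (2s≡ t)) (cong (_∸ 1) (2s≡′ t)))
    (cong₂ _,_ (cong (_∸ 2) (4s≡ t)) (cong (_∸ 1) (4s≡′ t)))
    where
    2s≡ : ∀ t → 2 * suc (suc t) ≡ suc (suc (2 * suc t + 0))
    2s≡ = solve-∀
    2s≡′ : ∀ t → 2 * suc (suc t) ≡ suc (2 * suc t + 1)
    2s≡′ = solve-∀
    4s≡ : ∀ t → 4 * suc (suc t) ≡ suc (suc (2 * suc (2 * suc t) + 0))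
    4s≡ = solve-∀
    4s≡′ : ∀ t → 4 * suc (suc t) ≡ suc (2 * suc (2 * suc t) + 1)
    4s≡′ = solve-∀

  aColumn : ℕ → Bool
  aColumn q = (q ≡ᵇ s-1) ∨ (q ≡ᵇ 2s-1)

  aFun-point : ∀ q r → aFun s (2 * q + bit r) ≡ 2 * q + bit (r xor aColumn q)
  aFun-point q r = trans (aFun≡swapRows (2 * q + bit r)) (swapRows-point s-1 2s-1 q r s-1≢2s-1)

  aFun-mapsInto : MapsInto (4 * s) (aFun s)
  aFun-mapsInto = by-points (λ j → aFun s j < 4 * s) λ q r q<2s →
    subst (_< 4 * s) (sym (aFun-point q r)) (point<4s q (r xor aColumn q) q<2s)

  mulA : Code → Code
  mulA (k , v) = (k , flipAt s-1 v)

  bitAt-flipAt : ∀ v q → q < 2s → bitAt (flipAt s-1 v) q ≡ bitAt v q xor aColumn q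
  bitAt-flipAt v q q<2s with q <? s
  ... | yes q<s rewrite bitAt-lo (flipAt s-1 v) q q<s | bitAt-lo v q q<s | at-flipAt s-1 v q q<s
                      | ≡ᵇ-false {q} {2s-1} (λ eq → <⇒≱ q<s (subst (s ≤_) (sym (trans eq 2s-1≡s+s-1)) (m≤m+n s s-1)))
                      | ∨-identityʳ (q ≡ᵇ s-1) = refl
  ... | no q≮s  rewrite bitAt-hi (flipAt s-1 v) q q≮s | bitAt-hi v q q≮s | at-flipAt s-1 v (q ∸ s) (q∸s<s q q<2s q≮s)
                      | ≡ᵇ-false {q} {s-1} (λ eq → q≮s (subst (_< s) (sym eq) (n<1+n s-1)))
                      | ≡ᵇ-cong {q ∸ s} {s-1} {q} {2s-1}
                          (λ eq → trans (sym (m∸n+n≡m (≮⇒≥ q≮s))) (trans (cong (_+ s) eq) (trans (+-comm s-1 s) (sym 2s-1≡s+s-1))))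
                          (λ eq → trans (cong (_∸ s) (trans eq 2s-1≡s+s-1)) (m+n∸m≡n s s-1)) = refl

  a-action : ∀ k v q r → q < 2s → action (k , v) (aFun s (2 * q + bit r)) ≡ action (mulA (k , v)) (2 * q + bit r)
  a-action k v q r q<2s rewrite aFun-point q r | action-point k v q (r xor aColumn q)
                             | action-point k (flipAt s-1 v) q r | bitAt-flipAt v q q<2s =
    cong (wrap (q + k)) (trans (xor-assoc r (aColumn q) (bitAt v q)) (cong (r xor_) (xor-comm (aColumn q) (bitAt v q))))

  a·encode : ∀ m → Valid m → a s · encode m ≡ encode (mulA m)
  a·encode (k , v) k<2s = mkPerm·encode (aFun s) (k , v) (mulA (k , v)) aFun-mapsInto k<2s (λ q r → a-action k v q r)

  idCode : Code
  idCode = 0 , tabulateℕ s (λ _ → false)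

  idCode-valid : Valid idCode
  idCode-valid = s≤s z≤n

  idP≡encode : idP ≡ encode idCode
  idP≡encode = begin
    idP                               ≡⟨ idP≡mkPerm-id ⟩
    mkPerm (4 * s) (λ j → j)          ≡⟨ mkPerm-cong _ (action idCode) (by-points (λ j → j ≡ action idCode j) id-action) ⟩
    mkPerm (4 * s) (action idCode)    ≡⟨ encode-def idCode ⟨
    encode idCode                     ∎
    where
    open ≡-Reasoning
    zeros = tabulateℕ s (λ _ → false)
    bitAt-zeros : ∀ q → q < 2s → bitAt zeros q ≡ false
    bitAt-zeros q q<2s with q <? s
    ... | yes q<s = trans (bitAt-lo zeros q q<s) (at-tabulateℕ s (λ _ → false) q q<s)
    ... | no  q≮s = trans (bitAt-hi zeros q q≮s) (at-tabulateℕ s (λ _ → false) (q ∸ s) (q∸s<s q q<2s q≮s))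
    id-action : ∀ q r → q < 2s → 2 * q + bit r ≡ action idCode (2 * q + bit r)
    id-action q r q<2s = sym (begin
      action idCode (2 * q + bit r)       ≡⟨ action-point 0 zeros q r ⟩
      wrap (q + 0) (r xor bitAt zeros q)  ≡⟨ wrap-lo (q + 0) _ (subst (_< 2s) (sym (+-identityʳ q)) q<2s) ⟩
      2 * (q + 0) + bit (r xor bitAt zeros q) ≡⟨ cong₂ (λ x c → 2 * x + bit c) (+-identityʳ q)
                                                  (trans (cong (r xor_) (bitAt-zeros q q<2s)) (xor-identityʳ r)) ⟩
      2 * q + bit r                       ∎)

  flip0 : Code → Code
  flip0 (k , v) = (k , flipAt 0 v)

  flipAt-involutive : ∀ p v → flipAt p (flipAt p v) ≡ v
  flipAt-involutive p v = at-ext _ _ λ i i<s → begin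
    at (flipAt p (flipAt p v)) i       ≡⟨ at-flipAt p (flipAt p v) i i<s ⟩
    at (flipAt p v) i xor (i ≡ᵇ p)     ≡⟨ cong (_xor (i ≡ᵇ p)) (at-flipAt p v i i<s) ⟩
    (at v i xor (i ≡ᵇ p)) xor (i ≡ᵇ p) ≡⟨ xor-cancelʳ (at v i) (i ≡ᵇ p) ⟩
    at v i                             ∎
    where open ≡-Reasoning

  flipAt-comm : ∀ p p′ v → flipAt p (flipAt p′ v) ≡ flipAt p′ (flipAt p v)
  flipAt-comm p p′ v = at-ext _ _ λ i i<s → begin
    at (flipAt p (flipAt p′ v)) i         ≡⟨ at-flipAt p (flipAt p′ v) i i<s ⟩
    at (flipAt p′ v) i xor (i ≡ᵇ p)       ≡⟨ cong (_xor (i ≡ᵇ p)) (at-flipAt p′ v i i<s) ⟩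
    (at v i xor (i ≡ᵇ p′)) xor (i ≡ᵇ p)   ≡⟨ xor-swapʳ (at v i) (i ≡ᵇ p′) (i ≡ᵇ p) ⟩
    (at v i xor (i ≡ᵇ p)) xor (i ≡ᵇ p′)   ≡⟨ cong (_xor (i ≡ᵇ p′)) (at-flipAt p v i i<s) ⟨
    at (flipAt p v) i xor (i ≡ᵇ p′)       ≡⟨ at-flipAt p′ (flipAt p v) i i<s ⟨
    at (flipAt p′ (flipAt p v)) i         ∎
    where open ≡-Reasoning

  mulA-involutive : ∀ m → mulA (mulA m) ≡ m
  mulA-involutive (k , v) = cong (k ,_) (flipAt-involutive s-1 v)

  flip0-involutive : ∀ m → flip0 (flip0 m) ≡ m
  flip0-involutive (k , v) = cong (k ,_) (flipAt-involutive 0 v)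

  mulA-flip0 : ∀ m → mulA (flip0 m) ≡ flip0 (mulA m)
  mulA-flip0 (k , v) = cong (k ,_) (flipAt-comm s-1 0 v)

  flip0-≢ : ∀ m → flip0 m ≢ m
  flip0-≢ (k , v) eq = not-≢-self (trans (sym (at-flipAt 0 v 0 (s≤s z≤n))) (cong (λ m → at (proj₂ m) 0) eq))
    where
    not-≢-self : ∀ {b} → b xor true ≢ b
    not-≢-self {true}  ()
    not-≢-self {false} ()

  rotate-flipAt-0 : ∀ v → rotate (flipAt 0 v) ≡ flipAt s-1 (rotate v)
  rotate-flipAt-0 v = at-ext _ _ entry
    where
    entry : ∀ i → i < s → at (rotate (flipAt 0 v)) i ≡ at (flipAt s-1 (rotate v)) i
    entry i i<s with m≤n⇒m<n∨m≡n i<s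
    ... | inj₁ 1+i<s = begin
      at (rotate (flipAt 0 v)) i              ≡⟨ at-rotate (flipAt 0 v) i 1+i<s ⟩
      at (flipAt 0 v) (suc i)                 ≡⟨ at-flipAt 0 v (suc i) 1+i<s ⟩
      at v (suc i) xor false                  ≡⟨ cong₂ _xor_ (at-rotate v i 1+i<s) (≡ᵇ-false (λ eq → <-irrefl (cong suc eq) 1+i<s)) ⟨
      at (rotate v) i xor (i ≡ᵇ s-1)          ≡⟨ at-flipAt s-1 (rotate v) i i<s ⟨
      at (flipAt s-1 (rotate v)) i            ∎
      where open ≡-Reasoning
    ... | inj₂ 1+i≡s with suc-injective 1+i≡s
    ...   | refl = begin
      at (rotate (flipAt 0 v)) s-1            ≡⟨ at-rotate-last (flipAt 0 v) ⟩
      at (flipAt 0 v) 0                       ≡⟨ at-flipAt 0 v 0 (s≤s z≤n) ⟩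
      at v 0 xor true                         ≡⟨ cong₂ _xor_ (at-rotate-last v) (≡ᵇ-true {s-1} refl) ⟨
      at (rotate v) s-1 xor (s-1 ≡ᵇ s-1)      ≡⟨ at-flipAt s-1 (rotate v) s-1 i<s ⟨
      at (flipAt s-1 (rotate v)) s-1          ∎
      where open ≡-Reasoning

  complement-flipAt : ∀ p v → complement (flipAt p v) ≡ flipAt p (complement v)
  complement-flipAt p v = at-ext _ _ λ i i<s → begin
    at (complement (flipAt p v)) i     ≡⟨ at-complement (flipAt p v) i i<s ⟩
    not (at (flipAt p v) i)            ≡⟨ cong not (at-flipAt p v i i<s) ⟩
    not (at v i xor (i ≡ᵇ p))          ≡⟨ not-distribˡ-xor (at v i) (i ≡ᵇ p) ⟩
    not (at v i) xor (i ≡ᵇ p)          ≡⟨ cong (_xor (i ≡ᵇ p)) (at-complement v i i<s) ⟨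
    at (complement v) i xor (i ≡ᵇ p)   ≡⟨ at-flipAt p (complement v) i i<s ⟨
    at (flipAt p (complement v)) i     ∎
    where open ≡-Reasoning

  mulA-mulB : ∀ m → Valid m → mulA (mulB m) ≡ mulB (flip0 m)
  mulA-mulB (k , v) k<2s with m≤n⇒m<n∨m≡n k<2s
  ... | inj₁ 1+k<2s rewrite mulB-inner k v 1+k<2s | mulB-inner k (flipAt 0 v) 1+k<2s = cong (suc k ,_) (sym (rotate-flipAt-0 v))
  ... | inj₂ 1+k≡2s rewrite mulB-wrap k v 1+k≡2s | mulB-wrap k (flipAt 0 v) 1+k≡2s =
    cong (0 ,_) (sym (trans (cong complement (rotate-flipAt-0 v)) (complement-flipAt s-1 (rotate v))))

  unrotate : Vec Bool s → Vec Bool s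
  unrotate v = tabulateℕ s (λ i → if i ≡ᵇ 0 then at v s-1 else at v (i ∸ 1))

  rotate-unrotate : ∀ v → rotate (unrotate v) ≡ v
  rotate-unrotate v = at-ext _ _ entry
    where
    unrotated : ℕ → Bool
    unrotated = λ i → if i ≡ᵇ 0 then at v s-1 else at v (i ∸ 1)
    entry : ∀ i → i < s → at (rotate (unrotate v)) i ≡ at v i
    entry i i<s with m≤n⇒m<n∨m≡n i<s
    ... | inj₁ 1+i<s = trans (at-rotate (unrotate v) i 1+i<s) (at-tabulateℕ s unrotated (suc i) 1+i<s)
    ... | inj₂ 1+i≡s with suc-injective 1+i≡s
    ...   | refl = trans (at-rotate-last (unrotate v)) (at-tabulateℕ s unrotated 0 (s≤s z≤n))

  rotate-injective : ∀ v w → rotate v ≡ rotate w → v ≡ w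
  rotate-injective v w eq = at-ext _ _ entry
    where
    entry : ∀ i → i < s → at v i ≡ at w i
    entry zero    _     = trans (sym (at-rotate-last v)) (trans (cong (λ x → at x s-1) eq) (at-rotate-last w))
    entry (suc i) 1+i<s = trans (sym (at-rotate v i 1+i<s)) (trans (cong (λ x → at x i) eq) (at-rotate w i 1+i<s))

  complement-involutive : ∀ v → complement (complement v) ≡ v
  complement-involutive v = at-ext _ _ λ i i<s →
    trans (at-complement (complement v) i i<s) (trans (cong not (at-complement v i i<s)) (not-involutive _))

  mulB⁻¹ : Code → Code
  mulB⁻¹ (zero  , v) = (2s-1 , unrotate (complement v))
  mulB⁻¹ (suc k , v) = (k , unrotate v)

  mulB⁻¹-valid : ∀ m → Valid m → Valid (mulB⁻¹ m)
  mulB⁻¹-valid (zero  , v) _     = 2s-1<2s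
  mulB⁻¹-valid (suc k , v) k<2s = <-trans (n<1+n k) k<2s

  mulB-mulB⁻¹ : ∀ m → Valid m → mulB (mulB⁻¹ m) ≡ m
  mulB-mulB⁻¹ (zero  , v) _ = trans (mulB-wrap 2s-1 (unrotate (complement v)) (sym 2s≡1+2s-1))
    (cong (0 ,_) (trans (cong complement (rotate-unrotate (complement v))) (complement-involutive v)))
  mulB-mulB⁻¹ (suc k , v) 1+k<2s = trans (mulB-inner k (unrotate v) 1+k<2s) (cong (suc k ,_) (rotate-unrotate v))

  mulB-injective : ∀ m m′ → Valid m → Valid m′ → mulB m ≡ mulB m′ → m ≡ m′
  mulB-injective (k , v) (k′ , v′) k<2s k′<2s eq with m≤n⇒m<n∨m≡n k<2s | m≤n⇒m<n∨m≡n k′<2s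
  ... | inj₁ 1+k<2s | inj₁ 1+k′<2s =
    let eq′ = trans (sym (mulB-inner k v 1+k<2s)) (trans eq (mulB-inner k′ v′ 1+k′<2s)) in
    cong₂ _,_ (suc-injective (cong proj₁ eq′)) (rotate-injective v v′ (cong proj₂ eq′))
  ... | inj₁ 1+k<2s | inj₂ 1+k′≡2s with cong proj₁ (trans (sym (mulB-inner k v 1+k<2s)) (trans eq (mulB-wrap k′ v′ 1+k′≡2s)))
  ...   | ()
  mulB-injective (k , v) (k′ , v′) k<2s k′<2s eq | inj₂ 1+k≡2s | inj₁ 1+k′<2s
    with cong proj₁ (trans (sym (mulB-wrap k v 1+k≡2s)) (trans eq (mulB-inner k′ v′ 1+k′<2s)))
  ...   | ()
  mulB-injective (k , v) (k′ , v′) k<2s k′<2s eq | inj₂ 1+k≡2s | inj₂ 1+k′≡2s =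
    let eq′ = trans (sym (mulB-wrap k v 1+k≡2s)) (trans eq (mulB-wrap k′ v′ 1+k′≡2s)) in
    cong₂ _,_ (suc-injective (trans 1+k≡2s (sym 1+k′≡2s)))
      (rotate-injective v v′ (trans (sym (complement-involutive (rotate v)))
        (trans (cong (λ m → complement (proj₂ m)) eq′) (complement-involutive (rotate v′)))))

  -- Decoding: the image of point 0 gives k, the images of the points 2 i give the bits of v.

  imageOf : Perm (4 * s) → ℕ → ℕ
  imageOf x j = toℕ (Vec.lookup x (finOr Fin.zero j))

  imageOf-encode : ∀ m → Valid m → ∀ j → j < 4 * s → imageOf (encode m) j ≡ action m j
  imageOf-encode m m-valid j j<4s = begin
    imageOf (encode m) j                                   ≡⟨ cong (λ x → imageOf x j) (encode-def m) ⟩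
    toℕ (Vec.lookup (mkPerm (4 * s) (action m)) (finOr Fin.zero j)) ≡⟨ toℕ-lookup-mkPerm (action m) (finOr Fin.zero j)
                                                                 (action-mapsInto m m-valid _ (subst (_< 4 * s) (sym toℕ-j) j<4s)) ⟩
    action m (toℕ (finOr Fin.zero j))                      ≡⟨ cong (action m) toℕ-j ⟩
    action m j                                             ∎
    where
    open ≡-Reasoning
    toℕ-j = toℕ-finOr Fin.zero j j<4s

  decodeShift : Perm (4 * s) → ℕ
  decodeShift x = proj₁ (halve (imageOf x 0))

  decodeBit : Perm (4 * s) → ℕ → Bool
  decodeBit x i = proj₂ (halve (imageOf x (2 * i + 0))) xor not ((i + decodeShift x) <ᵇ 2s)

  decode : Perm (4 * s) → Code
  decode x = decodeShift x , tabulateℕ s (decodeBit x)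

  decode-encode : ∀ m → Valid m → decode (encode m) ≡ m
  decode-encode (k , v) k<2s =
    cong₂ _,_ decodeShift-encode (at-ext _ _ λ i i<s → trans (at-tabulateℕ s (decodeBit x) i i<s) (decodeBit-encode i i<s))
    where
    x = encode (k , v)
    decodeShift-encode : decodeShift x ≡ k
    decodeShift-encode = begin
      proj₁ (halve (imageOf x 0))                        ≡⟨ cong (λ j → proj₁ (halve j)) (imageOf-encode (k , v) k<2s 0 (point<4s 0 false (s≤s z≤n))) ⟩
      proj₁ (halve (action (k , v) (2 * 0 + bit false))) ≡⟨ cong (λ j → proj₁ (halve j)) (trans (action-point k v 0 false) (wrap-lo k (at v 0) k<2s)) ⟩
      proj₁ (halve (2 * k + bit (at v 0)))               ≡⟨ cong proj₁ (halve-2*+bit k (at v 0)) ⟩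
      k                                                  ∎
      where open ≡-Reasoning
    decodeBit-encode : ∀ i → i < s → decodeBit x i ≡ at v i
    decodeBit-encode i i<s rewrite decodeShift-encode | imageOf-encode (k , v) k<2s (2 * i + 0) (point<4s i false (<-≤-trans i<s s≤2s))
                                 | action-point k v i false | bitAt-lo v i i<s with (i + k) <? 2s
    ... | yes i+k<2s rewrite wrap-lo (i + k) (at v i) i+k<2s | halve-2*+bit (i + k) (at v i) | <ᵇ-true i+k<2s = xor-identityʳ (at v i)
    ... | no  i+k≮2s rewrite wrap-hi (i + k) (at v i) i+k≮2s | halve-2*+bit (i + k ∸ 2s) (not (at v i)) | <ᵇ-false i+k≮2s =
      trans (xor-comm (not (at v i)) true) (not-involutive (at v i))

  encode-injective : ∀ m m′ → Valid m → Valid m′ → encode m ≡ encode m′ → m ≡ m′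
  encode-injective m m′ m-valid m′-valid eq = trans (sym (decode-encode m m-valid)) (trans (cong decode eq) (decode-encode m′ m′-valid))

  data Reachable : Code → Set where
    start : Reachable idCode
    stepA : ∀ {m} → Reachable m → Reachable (mulA m)
    stepB : ∀ {m} → Reachable m → Reachable (mulB m)

  Reachable⇒Valid : ∀ {m} → Reachable m → Valid m
  Reachable⇒Valid start         = idCode-valid
  Reachable⇒Valid (stepA r)     = Reachable⇒Valid r
  Reachable⇒Valid (stepB {m} r) = mulB-valid m (Reachable⇒Valid r)

  shiftIn : ℕ → Vec Bool s → Vec Bool s
  shiftIn j w = tabulateℕ s (λ i → if i + j <ᵇ s then false else at w (i + j ∸ s))

  at-shiftIn : ∀ j w i → i < s → at (shiftIn j w) i ≡ (if i + j <ᵇ s then false else at w (i + j ∸ s))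
  at-shiftIn j w = at-tabulateℕ s (λ i → if i + j <ᵇ s then false else at w (i + j ∸ s))

  shiftIn-s : ∀ w → shiftIn s w ≡ w
  shiftIn-s w = at-ext _ _ λ i i<s →
    trans (at-shiftIn s w i i<s) (trans (if-false (<ᵇ-false (λ lt → <-irrefl refl (≤-<-trans (m≤n+m s i) lt))))
          (cong (at w) (m+n∸n≡m i s)))

  -- b rotates the bits, and an a before the next b sets the bit entering at position s - 1.
  shiftIn-reachable : ∀ j → j ≤ s → ∀ w → Reachable (j , shiftIn j w)
  shiftIn-reachable zero _ w = subst Reachable (cong (0 ,_) (at-ext _ _ λ i i<s →
    trans (at-tabulateℕ s (λ _ → false) i i<s)
          (sym (trans (at-shiftIn 0 w i i<s) (if-true (<ᵇ-true (subst (_< s) (sym (+-identityʳ i)) i<s))))))) start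
  shiftIn-reachable (suc j) 1+j≤s w = subst Reachable (sym (cong (suc j ,_) shiftIn-step)) (reach-with (at w j))
    where
    reach-j = shiftIn-reachable j (≤-trans (n≤1+n j) 1+j≤s) w
    1+j<2s : suc j < 2s
    1+j<2s = ≤-<-trans 1+j≤s s<2s
    rotated = rotate (shiftIn j w)
    entering : Bool → Vec Bool s
    entering true  = flipAt s-1 rotated
    entering false = rotated
    reach-with : ∀ c → Reachable (suc j , entering c)
    reach-with true  = subst Reachable (cong mulA (mulB-inner j (shiftIn j w) 1+j<2s)) (stepA (stepB reach-j))
    reach-with false = subst Reachable (mulB-inner j (shiftIn j w) 1+j<2s) (stepB reach-j)
    entry : ∀ i → i < s → at (shiftIn (suc j) w) i ≡ at (entering (at w j)) i
    entry i i<s with m≤n⇒m<n∨m≡n i<s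
    ... | inj₁ 1+i<s = begin
      at (shiftIn (suc j) w) i                                           ≡⟨ at-shiftIn (suc j) w i i<s ⟩
      (if i + suc j <ᵇ s then false else at w (i + suc j ∸ s))           ≡⟨ cong (λ n → if n <ᵇ s then false else at w (n ∸ s)) (+-suc i j) ⟩
      (if suc i + j <ᵇ s then false else at w (suc i + j ∸ s))           ≡⟨ at-shiftIn j w (suc i) 1+i<s ⟨
      at (shiftIn j w) (suc i)                                           ≡⟨ at-rotate (shiftIn j w) i 1+i<s ⟨
      at rotated i                                                       ≡⟨ unchanged (at w j) ⟨
      at (entering (at w j)) i                                           ∎
      where
      open ≡-Reasoning
      unchanged : ∀ c → at (entering c) i ≡ at rotated i
      unchanged true  = trans (at-flipAt s-1 rotated i i<s)
        (trans (cong (at rotated i xor_) (≡ᵇ-false (λ eq → <-irrefl (cong suc eq) 1+i<s))) (xor-identityʳ _))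
      unchanged false = refl
    ... | inj₂ 1+i≡s with suc-injective 1+i≡s
    ...   | refl = begin
      at (shiftIn (suc j) w) s-1                                       ≡⟨ at-shiftIn (suc j) w s-1 i<s ⟩
      (if s-1 + suc j <ᵇ s then false else at w (s-1 + suc j ∸ s))     ≡⟨ if-false (<ᵇ-false (λ lt → <-irrefl refl
                                                                              (≤-<-trans (m≤m+n s j) (subst (_< s) (+-suc s-1 j) lt)))) ⟩
      at w (s-1 + suc j ∸ s)                                           ≡⟨ cong (at w) (trans (cong (_∸ s) (+-suc s-1 j)) (m+n∸m≡n s j)) ⟩
      at w j                                                           ≡⟨ entered (at w j) ⟨
      at (entering (at w j)) s-1                                       ∎
      where
      open ≡-Reasoning
      rotated-last : at rotated s-1 ≡ false
      rotated-last = trans (at-rotate-last (shiftIn j w)) (trans (at-shiftIn j w 0 (s≤s z≤n)) (if-true (<ᵇ-true (s≤s 1+j≤s))))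
      entered : ∀ c → at (entering c) s-1 ≡ c
      entered true  = trans (at-flipAt s-1 rotated s-1 i<s) (cong₂ _xor_ rotated-last (≡ᵇ-true {s-1} refl))
      entered false = rotated-last
    shiftIn-step : shiftIn (suc j) w ≡ entering (at w j)
    shiftIn-step = at-ext _ _ entry

  reachable-+ : ∀ k j → (∀ w → Reachable (k , w)) → k + j < 2s → ∀ w → Reachable (k + j , w)
  reachable-+ k zero    reach-k _   w = subst (λ n → Reachable (n , w)) (sym (+-identityʳ k)) (reach-k w)
  reachable-+ k (suc j) reach-k lt w = subst (λ n → Reachable (n , w)) (sym (+-suc k j))
    (subst Reachable (mulB-mulB⁻¹ (suc (k + j) , w) (subst (_< 2s) (+-suc k j) lt))
      (stepB (reachable-+ k j reach-k (<-trans (subst (k + j <_) (sym (+-suc k j)) (n<1+n (k + j))) lt) (unrotate w))))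

  Valid⇒Reachable : ∀ m → Valid m → Reachable m
  Valid⇒Reachable (k , w) k<2s = reachable-+ 0 k reach-0 k<2s w
    where
    reach-s : ∀ w → Reachable (s , w)
    reach-s w = subst (λ v → Reachable (s , v)) (shiftIn-s w) (shiftIn-reachable s ≤-refl w)
    reach-2s-1 : ∀ w → Reachable (2s-1 , w)
    reach-2s-1 w = subst (λ n → Reachable (n , w)) (sym 2s-1≡s+s-1)
      (reachable-+ s s-1 reach-s (subst (_< 2s) 2s-1≡s+s-1 2s-1<2s) w)
    reach-0 : ∀ w → Reachable (0 , w)
    reach-0 w = subst Reachable (mulB-mulB⁻¹ (0 , w) (s≤s z≤n)) (stepB (reach-2s-1 (unrotate (complement w))))

  Encoded : Perm (4 * s) → Set
  Encoded x = Σ Code (λ m → Valid m × x ≡ encode m)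

  encode-Encoded : ∀ m → Valid m → Encoded (encode m)
  encode-Encoded m m-valid = m , m-valid , refl

  a≡encode : a s ≡ encode (mulA idCode)
  a≡encode = trans (sym (·-identityʳ (a s))) (trans (cong (a s ·_) idP≡encode) (a·encode idCode idCode-valid))

  b≡encode : b s ≡ encode (mulB idCode)
  b≡encode = trans (sym (·-identityʳ (b s))) (trans (cong (b s ·_) idP≡encode) (b·encode idCode idCode-valid))

  Encoded-idP : Encoded idP
  Encoded-idP = idCode , idCode-valid , idP≡encode

  Encoded-a : Encoded (a s)
  Encoded-a = mulA idCode , idCode-valid , a≡encode

  Encoded-b : Encoded (b s)
  Encoded-b = mulB idCode , mulB-valid idCode idCode-valid , b≡encode

  reachable-· : ∀ {m} → Reachable m → ∀ m′ → Valid m′ → Encoded (encode m · encode m′)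
  reachable-· start m′ m′-valid = m′ , m′-valid , trans (cong (_· encode m′) (sym idP≡encode)) (·-identityˡ _)
  reachable-· (stepA {m} r) m′ m′-valid with reachable-· r m′ m′-valid
  ... | m″ , m″-valid , eq = mulA m″ , m″-valid , (begin
    encode (mulA m) · encode m′    ≡⟨ cong (_· encode m′) (a·encode m (Reachable⇒Valid r)) ⟨
    (a s · encode m) · encode m′   ≡⟨ ·-assoc (a s) (encode m) (encode m′) ⟩
    a s · (encode m · encode m′)   ≡⟨ cong (a s ·_) eq ⟩
    a s · encode m″                ≡⟨ a·encode m″ m″-valid ⟩
    encode (mulA m″)               ∎)
    where open ≡-Reasoning
  reachable-· (stepB {m} r) m′ m′-valid with reachable-· r m′ m′-valid
  ... | m″ , m″-valid , eq = mulB m″ , mulB-valid m″ m″-valid , (begin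
    encode (mulB m) · encode m′    ≡⟨ cong (_· encode m′) (b·encode m (Reachable⇒Valid r)) ⟨
    (b s · encode m) · encode m′   ≡⟨ ·-assoc (b s) (encode m) (encode m′) ⟩
    b s · (encode m · encode m′)   ≡⟨ cong (b s ·_) eq ⟩
    b s · encode m″                ≡⟨ b·encode m″ m″-valid ⟩
    encode (mulB m″)               ∎)
    where open ≡-Reasoning

  Encoded-· : ∀ {x y} → Encoded x → Encoded y → Encoded (x · y)
  Encoded-· (m , m-valid , refl) (m′ , m′-valid , refl) = reachable-· (Valid⇒Reachable m m-valid) m′ m′-valid

  -- b has order 4s: 2s steps shift a constant vector back to column 0 complemented.

  b^ : ℕ → Perm (4 * s) → Perm (4 * s)
  b^ zero    x = x
  b^ (suc j) x = b s · b^ j x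

  mulB^ : ℕ → Code → Code
  mulB^ zero    m = m
  mulB^ (suc j) m = mulB (mulB^ j m)

  mulB^-valid : ∀ j m → Valid m → Valid (mulB^ j m)
  mulB^-valid zero    m m-valid = m-valid
  mulB^-valid (suc j) m m-valid = mulB-valid (mulB^ j m) (mulB^-valid j m m-valid)

  b^-encode : ∀ j m → Valid m → b^ j (encode m) ≡ encode (mulB^ j m)
  b^-encode zero    m m-valid = refl
  b^-encode (suc j) m m-valid = trans (cong (b s ·_) (b^-encode j m m-valid)) (b·encode (mulB^ j m) (mulB^-valid j m m-valid))

  b^-suc : ∀ j x → b^ j (b s · x) ≡ b^ (suc j) x
  b^-suc zero    x = refl
  b^-suc (suc j) x = cong (b s ·_) (b^-suc j x)

  b^-· : ∀ j x y → b^ j (x · y) ≡ b^ j x · y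
  b^-· zero    x y = refl
  b^-· (suc j) x y = trans (cong (b s ·_) (b^-· j x y)) (sym (·-assoc (b s) (b^ j x) y))

  mulB^-+ : ∀ i j m → mulB^ (i + j) m ≡ mulB^ i (mulB^ j m)
  mulB^-+ zero    j m = refl
  mulB^-+ (suc i) j m = cong mulB (mulB^-+ i j m)

  constant : Bool → Vec Bool s
  constant c = tabulateℕ s (λ _ → c)

  rotate-constant : ∀ c → rotate (constant c) ≡ constant c
  rotate-constant c = at-ext _ _ entry
    where
    entry : ∀ i → i < s → at (rotate (constant c)) i ≡ at (constant c) i
    entry i i<s with m≤n⇒m<n∨m≡n i<s
    ... | inj₁ 1+i<s = trans (at-rotate (constant c) i 1+i<s)
                        (trans (at-tabulateℕ s (λ _ → c) (suc i) 1+i<s) (sym (at-tabulateℕ s (λ _ → c) i i<s)))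
    ... | inj₂ 1+i≡s with suc-injective 1+i≡s
    ...   | refl = trans (at-rotate-last (constant c))
                     (trans (at-tabulateℕ s (λ _ → c) 0 (s≤s z≤n)) (sym (at-tabulateℕ s (λ _ → c) s-1 i<s)))

  complement-constant : ∀ c → complement (constant c) ≡ constant (not c)
  complement-constant c = at-ext _ _ λ i i<s → trans (at-complement (constant c) i i<s)
    (trans (cong not (at-tabulateℕ s (λ _ → c) i i<s)) (sym (at-tabulateℕ s (λ _ → not c) i i<s)))

  mulB^-constant : ∀ j → j < 2s → ∀ c → mulB^ j (0 , constant c) ≡ (j , constant c)
  mulB^-constant zero    _    c = refl
  mulB^-constant (suc j) 1+j<2s c = trans (cong mulB (mulB^-constant j (<-trans (n<1+n j) 1+j<2s) c))
    (trans (mulB-inner j (constant c) 1+j<2s) (cong (suc j ,_) (rotate-constant c)))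

  mulB^2s-constant : ∀ c → mulB^ 2s (0 , constant c) ≡ (0 , constant (not c))
  mulB^2s-constant c = begin
    mulB^ 2s (0 , constant c)                  ≡⟨ cong (λ j → mulB^ j (0 , constant c)) 2s≡1+2s-1 ⟩
    mulB (mulB^ 2s-1 (0 , constant c))         ≡⟨ cong mulB (mulB^-constant 2s-1 2s-1<2s c) ⟩
    mulB (2s-1 , constant c)                   ≡⟨ mulB-wrap 2s-1 (constant c) (sym 2s≡1+2s-1) ⟩
    (0 , complement (rotate (constant c)))     ≡⟨ cong (λ v → 0 , complement v) (rotate-constant c) ⟩
    (0 , complement (constant c))              ≡⟨ cong (0 ,_) (complement-constant c) ⟩
    (0 , constant (not c))                     ∎
    where open ≡-Reasoning

  b^4s : ∀ x → b^ (4 * s) x ≡ x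
  b^4s x = begin
    b^ (4 * s) x                                 ≡⟨ cong (b^ (4 * s)) (·-identityˡ x) ⟨
    b^ (4 * s) (idP · x)                         ≡⟨ b^-· (4 * s) idP x ⟩
    b^ (4 * s) idP · x                           ≡⟨ cong (λ y → b^ (4 * s) y · x) idP≡encode ⟩
    b^ (4 * s) (encode idCode) · x               ≡⟨ cong (_· x) (b^-encode (4 * s) idCode idCode-valid) ⟩
    encode (mulB^ (4 * s) idCode) · x            ≡⟨ cong (λ m → encode m · x) mulB^4s ⟩
    encode idCode · x                            ≡⟨ cong (_· x) idP≡encode ⟨
    idP · x                                      ≡⟨ ·-identityˡ x ⟩
    x                                            ∎
    where
    open ≡-Reasoning
    mulB^4s : mulB^ (4 * s) idCode ≡ idCode
    mulB^4s = begin
      mulB^ (4 * s) idCode                     ≡⟨ cong (λ j → mulB^ j idCode) (trans 4s≡2*2s (2*n≡n+n 2s)) ⟩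
      mulB^ (2s + 2s) idCode                   ≡⟨ mulB^-+ 2s 2s idCode ⟩
      mulB^ 2s (mulB^ 2s (0 , constant false)) ≡⟨ cong (mulB^ 2s) (mulB^2s-constant false) ⟩
      mulB^ 2s (0 , constant true)             ≡⟨ mulB^2s-constant true ⟩
      idCode                                   ∎

  b⁻¹ : Perm (4 * s)
  b⁻¹ = b^ (4 * s ∸ 1) idP

  Encoded-b⁻¹ : Encoded b⁻¹
  Encoded-b⁻¹ = mulB^ (4 * s ∸ 1) idCode , mulB^-valid (4 * s ∸ 1) idCode idCode-valid ,
                trans (cong (b^ (4 * s ∸ 1)) idP≡encode) (b^-encode (4 * s ∸ 1) idCode idCode-valid)

  b⁻¹·b· : ∀ x → b⁻¹ · (b s · x) ≡ x
  b⁻¹·b· x = begin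
    b^ (4 * s ∸ 1) idP · (b s · x)    ≡⟨ b^-· (4 * s ∸ 1) idP (b s · x) ⟨
    b^ (4 * s ∸ 1) (idP · (b s · x))  ≡⟨ cong (b^ (4 * s ∸ 1)) (·-identityˡ (b s · x)) ⟩
    b^ (4 * s ∸ 1) (b s · x)          ≡⟨ b^-suc (4 * s ∸ 1) x ⟩
    b^ (suc (4 * s ∸ 1)) x            ≡⟨ b^4s x ⟩
    x                                 ∎
    where open ≡-Reasoning

  a·a· : ∀ x → a s · (a s · x) ≡ x
  a·a· x = begin
    a s · (a s · x)                    ≡⟨ ·-assoc (a s) (a s) x ⟨
    (a s · a s) · x                    ≡⟨ cong (λ y → (a s · y) · x) a≡encode ⟩
    (a s · encode (mulA idCode)) · x   ≡⟨ cong (_· x) (a·encode (mulA idCode) idCode-valid) ⟩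
    encode (mulA (mulA idCode)) · x    ≡⟨ cong (λ m → encode m · x) (mulA-involutive idCode) ⟩
    encode idCode · x                  ≡⟨ cong (_· x) idP≡encode ⟨
    idP · x                            ≡⟨ ·-identityˡ x ⟩
    x                                  ∎
    where open ≡-Reasoning

  LeftInverse : Perm (4 * s) → Set
  LeftInverse x = Σ (Perm (4 * s)) (λ y → Encoded y × y · x ≡ idP)

  reachable-leftInverse : ∀ {m} → Reachable m → LeftInverse (encode m)
  reachable-leftInverse start = idP , Encoded-idP , trans (·-identityˡ _) (sym idP≡encode)
  reachable-leftInverse (stepA {m} r) with reachable-leftInverse r
  ... | y , y-encoded , y·m≡id = y · a s , Encoded-· y-encoded Encoded-a , (begin
    (y · a s) · encode (mulA m)       ≡⟨ cong ((y · a s) ·_) (a·encode m (Reachable⇒Valid r)) ⟨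
    (y · a s) · (a s · encode m)      ≡⟨ ·-assoc y (a s) (a s · encode m) ⟩
    y · (a s · (a s · encode m))      ≡⟨ cong (y ·_) (a·a· (encode m)) ⟩
    y · encode m                      ≡⟨ y·m≡id ⟩
    idP                               ∎)
    where open ≡-Reasoning
  reachable-leftInverse (stepB {m} r) with reachable-leftInverse r
  ... | y , y-encoded , y·m≡id = y · b⁻¹ , Encoded-· y-encoded Encoded-b⁻¹ , (begin
    (y · b⁻¹) · encode (mulB m)       ≡⟨ cong ((y · b⁻¹) ·_) (b·encode m (Reachable⇒Valid r)) ⟨
    (y · b⁻¹) · (b s · encode m)      ≡⟨ ·-assoc y b⁻¹ (b s · encode m) ⟩
    y · (b⁻¹ · (b s · encode m))      ≡⟨ cong (y ·_) (b⁻¹·b· (encode m)) ⟩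
    y · encode m                      ≡⟨ y·m≡id ⟩
    idP                               ∎)
    where open ≡-Reasoning

  Encoded-leftInverse : ∀ {x} → Encoded x → LeftInverse x
  Encoded-leftInverse (m , m-valid , refl) = reachable-leftInverse (Valid⇒Reachable m m-valid)

  R⇒Encoded : ∀ {x} → R s x → Encoded x
  R⇒Encoded gen-id        = Encoded-idP
  R⇒Encoded gen-a         = Encoded-a
  R⇒Encoded gen-b         = Encoded-b
  R⇒Encoded (gen-mul p q) = Encoded-· (R⇒Encoded p) (R⇒Encoded q)
  R⇒Encoded (gen-inv {p} {q} p∈R p·q≡id) with Encoded-leftInverse (R⇒Encoded p∈R)
  ... | y , y-encoded , y·p≡id = subst Encoded (begin
    y                ≡⟨ ·-identityʳ y ⟨
    y · idP          ≡⟨ cong (y ·_) p·q≡id ⟨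
    y · (p · q)      ≡⟨ ·-assoc y p q ⟨
    (y · p) · q      ≡⟨ cong (_· q) y·p≡id ⟩
    idP · q          ≡⟨ ·-identityˡ q ⟩
    q                ∎) y-encoded
    where open ≡-Reasoning

  Reachable⇒R : ∀ {m} → Reachable m → R s (encode m)
  Reachable⇒R start         = subst (R s) idP≡encode gen-id
  Reachable⇒R (stepA {m} r) = subst (R s) (a·encode m (Reachable⇒Valid r)) (gen-mul gen-a (Reachable⇒R r))
  Reachable⇒R (stepB {m} r) = subst (R s) (b·encode m (Reachable⇒Valid r)) (gen-mul gen-b (Reachable⇒R r))

  Encoded⇒R : ∀ {x} → Encoded x → R s x
  Encoded⇒R (m , m-valid , refl) = Reachable⇒R (Valid⇒Reachable m m-valid)

  encode∈R : ∀ m → Valid m → R s (encode m)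
  encode∈R m m-valid = Encoded⇒R (encode-Encoded m m-valid)

  Inverse : Perm (4 * s) → Set
  Inverse x = Σ (Perm (4 * s)) (λ y → Encoded y × y · x ≡ idP × x · y ≡ idP)

  Encoded-inverse : ∀ {x} → Encoded x → Inverse x
  Encoded-inverse {x} x-encoded with Encoded-leftInverse x-encoded
  ... | y , y-encoded , y·x≡id with Encoded-leftInverse y-encoded
  ...   | z , _ , z·y≡id = y , y-encoded , y·x≡id , ·-inverseʳ x y z y·x≡id z·y≡id

  flipIf : Bool → Code → Code
  flipIf true  = flip0
  flipIf false = λ m → m

  flipIf-valid : ∀ c m → Valid m → Valid (flipIf c m)
  flipIf-valid true  m m-valid = m-valid
  flipIf-valid false m m-valid = m-valid

  flipIf-flipIf : ∀ c c′ m → flipIf c (flipIf c′ m) ≡ flipIf (c xor c′) m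
  flipIf-flipIf true  true  m = flip0-involutive m
  flipIf-flipIf true  false m = refl
  flipIf-flipIf false c′    m = refl

  mulA-flipIf : ∀ c m → mulA (flipIf c m) ≡ flipIf c (mulA m)
  mulA-flipIf true  m = mulA-flip0 m
  mulA-flipIf false m = refl

  successor : Bool → Code → Code
  successor c m = mulB (flipIf c m)

  successor-valid : ∀ c m → Valid m → Valid (successor c m)
  successor-valid c m m-valid = mulB-valid (flipIf c m) (flipIf-valid c m m-valid)

  generator : Bool → Perm (4 * s)
  generator true  = a s · b s
  generator false = b s

  generator·encode : ∀ c m → Valid m → generator c · encode m ≡ encode (successor c m)
  generator·encode true m m-valid = begin
    (a s · b s) · encode m    ≡⟨ ·-assoc (a s) (b s) (encode m) ⟩
    a s · (b s · encode m)    ≡⟨ cong (a s ·_) (b·encode m m-valid) ⟩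
    a s · encode (mulB m)     ≡⟨ a·encode (mulB m) (mulB-valid m m-valid) ⟩
    encode (mulA (mulB m))    ≡⟨ cong encode (mulA-mulB m m-valid) ⟩
    encode (mulB (flip0 m))   ∎
    where open ≡-Reasoning
  generator·encode false m m-valid = b·encode m m-valid

  ∈-connectionSet : ∀ {z} → z ∈ (a s · b s) List.∷ b s List.∷ List.[] → Σ Bool (λ c → z ≡ generator c)
  ∈-connectionSet (here z≡ab)         = true , z≡ab
  ∈-connectionSet (there (here z≡b))  = false , z≡b

  generator∈connectionSet : ∀ c → generator c ∈ (a s · b s) List.∷ b s List.∷ List.[]
  generator∈connectionSet true  = here refl
  generator∈connectionSet false = there (here refl)

  Successor : Code → Perm (4 * s) → Set
  Successor m y = Σ Bool (λ c → y ≡ encode (successor c m))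

  arc⇒Successor : ∀ m → Valid m → ∀ {y} → ΓArc s (encode m) y → Successor m y
  arc⇒Successor m m-valid {y} (_ , _ , z , x·z≡id , y·z∈S) with Encoded-leftInverse (encode-Encoded m m-valid)
  ... | r , _ , r·x≡id with ∈-connectionSet y·z∈S
  ...   | c , y·z≡g = c , (begin
    y                          ≡⟨ ·-cancelʳ y r (encode m) r·x≡id ⟨
    (y · r) · encode m         ≡⟨ cong (λ w → (y · w) · encode m) (·-inverse-unique (encode m) r z r·x≡id x·z≡id) ⟨
    (y · z) · encode m         ≡⟨ cong (_· encode m) y·z≡g ⟩
    generator c · encode m     ≡⟨ generator·encode c m m-valid ⟩
    encode (successor c m)     ∎)
    where open ≡-Reasoning

  connectionSet : List (Perm (4 * s))
  connectionSet = (a s · b s) List.∷ b s List.∷ List.[]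

  Successor⇒arc : ∀ m → Valid m → ∀ {y} → Successor m y → ΓArc s (encode m) y
  Successor⇒arc m m-valid (c , refl) =
    encode∈R m m-valid , encode∈R (successor c m) (successor-valid c m m-valid) , r , x·r≡id , y·r∈S
    where
    inverse = Encoded-inverse (encode-Encoded m m-valid)
    r = proj₁ inverse
    x·r≡id : encode m · r ≡ idP
    x·r≡id = proj₂ (proj₂ (proj₂ inverse))
    y·r≡g : encode (successor c m) · r ≡ generator c
    y·r≡g = begin
      encode (successor c m) · r            ≡⟨ cong (_· r) (generator·encode c m m-valid) ⟨
      (generator c · encode m) · r          ≡⟨ ·-cancelʳ (generator c) (encode m) r x·r≡id ⟩
      generator c                           ∎
      where open ≡-Reasoning
    y·r∈S : encode (successor c m) · r ∈ connectionSet
    y·r∈S = subst (_∈ connectionSet) (sym y·r≡g) (generator∈connectionSet c)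

  arc-successor : ∀ c m → Valid m → ΓArc s (encode m) (encode (successor c m))
  arc-successor c m m-valid = Successor⇒arc m m-valid (c , refl)

  successor-injective : ∀ c c′ m m′ → Valid m → Valid m′ →
                        encode (successor c m) ≡ encode (successor c′ m′) → flipIf c m ≡ flipIf c′ m′
  successor-injective c c′ m m′ m-valid m′-valid eq =
    mulB-injective _ _ (flipIf-valid c m m-valid) (flipIf-valid c′ m′ m′-valid) (encode-injective _ _ (successor-valid c m m-valid) (successor-valid c′ m′ m′-valid) eq)

  successors-distinct : ∀ m → Valid m → encode (successor true m) ≢ encode (successor false m)
  successors-distinct m m-valid eq = flip0-≢ m (successor-injective true false m m m-valid m-valid eq)

  out-neighbours : ∀ m → Valid m → HasCard (ΓArc s (encode m)) 2
  out-neighbours m m-valid =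
    encode (successor true m) List.∷ encode (successor false m) List.∷ List.[] , refl ,
    ((successors-distinct m m-valid ∷ []) ∷ ([] ∷ [])) ,
    λ y → mk⇔ (λ arc → Successor⇒∈ (arc⇒Successor m m-valid arc)) (λ y∈ → Successor⇒arc m m-valid (∈⇒Successor y∈))
    where
    Successor⇒∈ : ∀ {y} → Successor m y → y ∈ encode (successor true m) List.∷ encode (successor false m) List.∷ List.[]
    Successor⇒∈ (true  , eq) = here eq
    Successor⇒∈ (false , eq) = there (here eq)
    ∈⇒Successor : ∀ {y} → y ∈ encode (successor true m) List.∷ encode (successor false m) List.∷ List.[] → Successor m y
    ∈⇒Successor (here eq)         = true , eq
    ∈⇒Successor (there (here eq)) = false , eq

  in-neighbours : ∀ m → Valid m → HasCard (λ y → ΓArc s y (encode m)) 2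
  in-neighbours m m-valid =
    encode (flip0 u) List.∷ encode u List.∷ List.[] , refl ,
    ((flip0-encode-≢ ∷ []) ∷ ([] ∷ [])) , λ y → mk⇔ to from
    where
    u = mulB⁻¹ m
    u-valid = mulB⁻¹-valid m m-valid
    mulB-u : mulB u ≡ m
    mulB-u = mulB-mulB⁻¹ m m-valid
    flip0-encode-≢ : encode (flip0 u) ≢ encode u
    flip0-encode-≢ eq = flip0-≢ u (encode-injective _ _ u-valid u-valid eq)
    predecessor : ∀ m′ → Valid m′ → Successor m′ (encode m) → encode m′ ∈ encode (flip0 u) List.∷ encode u List.∷ List.[]
    predecessor m′ m′-valid (c , eq) =
      flipIf≡u⇒∈ c (successor-injective c false m′ u m′-valid u-valid (trans (sym eq) (cong encode (sym mulB-u))))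
      where
      flipIf≡u⇒∈ : ∀ c → flipIf c m′ ≡ u → encode m′ ∈ encode (flip0 u) List.∷ encode u List.∷ List.[]
      flipIf≡u⇒∈ true  flip0-m′≡u = here (cong encode (trans (sym (flip0-involutive m′)) (cong flip0 flip0-m′≡u)))
      flipIf≡u⇒∈ false m′≡u       = there (here (cong encode m′≡u))
    encoded-predecessor : ∀ {y} → Encoded y → ΓArc s y (encode m) → y ∈ encode (flip0 u) List.∷ encode u List.∷ List.[]
    encoded-predecessor (m′ , m′-valid , refl) arc = predecessor m′ m′-valid (arc⇒Successor m′ m′-valid arc)
    to : ∀ {y} → ΓArc s y (encode m) → y ∈ encode (flip0 u) List.∷ encode u List.∷ List.[]
    to arc = encoded-predecessor (R⇒Encoded (proj₁ arc)) arc
    from : ∀ {y} → y ∈ encode (flip0 u) List.∷ encode u List.∷ List.[] → ΓArc s y (encode m)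
    from (here refl) = Successor⇒arc (flip0 u) u-valid (true , cong encode (sym (trans (cong mulB (flip0-involutive u)) mulB-u)))
    from (there (here refl)) = Successor⇒arc u u-valid (false , cong encode (sym mulB-u))

  regular : RegularOfValency (R s) (ΓArc s) 2
  regular x x∈R = neighbours (R⇒Encoded x∈R)
    where
    neighbours : ∀ {x} → Encoded x → HasCard (ΓArc s x) 2 × HasCard (λ y → ΓArc s y x) 2
    neighbours (m , m-valid , refl) = out-neighbours m m-valid , in-neighbours m m-valid

  -- Strong connectivity: a walk from z to encode m · z follows the letters of a path reaching m,
  -- a being realised as b^(4s-1) followed by a b.

  arc-b· : ∀ {z} → Encoded z → ΓArc s z (b s · z)
  arc-b· (m , m-valid , refl) = Successor⇒arc m m-valid (false , b·encode m m-valid)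

  arc-ab· : ∀ {z} → Encoded z → ΓArc s z ((a s · b s) · z)
  arc-ab· (m , m-valid , refl) = Successor⇒arc m m-valid (true , generator·encode true m m-valid)

  Encoded-b^ : ∀ j {z} → Encoded z → Encoded (b^ j z)
  Encoded-b^ zero    z-encoded = z-encoded
  Encoded-b^ (suc j) z-encoded = Encoded-· Encoded-b (Encoded-b^ j z-encoded)

  walk-b^ : ∀ j {z} → Encoded z → Star (ΓArc s) z (b^ j z)
  walk-b^ zero    _         = ε
  walk-b^ (suc j) z-encoded = walk-b^ j z-encoded ◅◅ (arc-b· (Encoded-b^ j z-encoded) ◅ ε)

  walk-a· : ∀ {z} → Encoded z → Star (ΓArc s) z (a s · z)
  walk-a· {z} z-encoded = subst (Star (ΓArc s) z) ab·b^≡a·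
    (walk-b^ (4 * s ∸ 1) z-encoded ◅◅ (arc-ab· (Encoded-b^ (4 * s ∸ 1) z-encoded) ◅ ε))
    where
    ab·b^≡a· : (a s · b s) · b^ (4 * s ∸ 1) z ≡ a s · z
    ab·b^≡a· = trans (·-assoc (a s) (b s) (b^ (4 * s ∸ 1) z)) (cong (a s ·_) (b^4s z))

  walk-encode· : ∀ {m} → Reachable m → ∀ {z} → Encoded z → Star (ΓArc s) z (encode m · z)
  walk-encode· start {z} _ = subst (Star (ΓArc s) z) (trans (sym (·-identityˡ z)) (cong (_· z) idP≡encode)) ε
  walk-encode· (stepA {m} r) {z} z-encoded =
    subst (Star (ΓArc s) z) (trans (sym (·-assoc (a s) (encode m) z)) (cong (_· z) (a·encode m (Reachable⇒Valid r))))
      (walk-encode· r z-encoded ◅◅ walk-a· (Encoded-· (encode-Encoded m (Reachable⇒Valid r)) z-encoded))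
  walk-encode· (stepB {m} r) {z} z-encoded =
    subst (Star (ΓArc s) z) (trans (sym (·-assoc (b s) (encode m) z)) (cong (_· z) (b·encode m (Reachable⇒Valid r))))
      (walk-encode· r z-encoded ◅◅ (arc-b· (Encoded-· (encode-Encoded m (Reachable⇒Valid r)) z-encoded) ◅ ε))

  stronglyConnected : StronglyConnected (R s) (ΓArc s)
  stronglyConnected x y x∈R y∈R = subst (Star (ΓArc s) x) m·x≡y (walk-encode· (Valid⇒Reachable m m-valid) (R⇒Encoded x∈R))
    where
    inverse = Encoded-inverse (R⇒Encoded x∈R)
    r = proj₁ inverse
    y·r = Encoded-· (R⇒Encoded y∈R) (proj₁ (proj₂ inverse))
    m = proj₁ y·r
    m-valid = proj₁ (proj₂ y·r)
    m·x≡y : encode m · x ≡ y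
    m·x≡y = begin
      encode m · x       ≡⟨ cong (_· x) (proj₂ (proj₂ y·r)) ⟨
      (y · r) · x        ≡⟨ ·-cancelʳ y r x (proj₁ (proj₂ (proj₂ inverse))) ⟩
      y                  ∎
      where open ≡-Reasoning

  codes : ℕ → List Code
  codes zero    = List.[]
  codes (suc k) = List.map (k ,_) (bitVecs s) ++ codes k

  length-codes : ∀ k → length (codes k) ≡ k * 2 ^ s
  length-codes zero = refl
  length-codes (suc k) rewrite length-++ (List.map (k ,_) (bitVecs s)) {codes k} | length-map (k ,_) (bitVecs s)
                             | length-bitVecs s | length-codes k = refl

  ∈-codes⇒< : ∀ k {m} → m ∈ codes k → proj₁ m < k
  ∈-codes⇒< (suc k) m∈ with ∈-++⁻ (List.map (k ,_) (bitVecs s)) m∈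
  ... | inj₁ m∈k with ∈-map⁻ (k ,_) m∈k
  ...   | _ , _ , refl = n<1+n k
  ∈-codes⇒< (suc k) m∈ | inj₂ m∈codes = <-trans (∈-codes⇒< k m∈codes) (n<1+n k)

  codes-unique : ∀ k → Unique (codes k)
  codes-unique zero    = []
  codes-unique (suc k) = Unique.++⁺ (Unique.map⁺ ,-injectiveʳ (bitVecs-unique s)) (codes-unique k) disjoint
    where
    ,-injectiveʳ : ∀ {v w : Vec Bool s} → (k , v) ≡ (k , w) → v ≡ w
    ,-injectiveʳ refl = refl
    disjoint : ∀ {m} → ¬ (m ∈ List.map (k ,_) (bitVecs s) × m ∈ codes k)
    disjoint (m∈k , m∈codes) with ∈-map⁻ (k ,_) m∈k
    ... | _ , _ , refl = <-irrefl refl (∈-codes⇒< k m∈codes)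

  <⇒∈-codes : ∀ K m → proj₁ m < K → m ∈ codes K
  <⇒∈-codes (suc K) (k , v) k<1+K with k ≟ K
  ... | yes refl = ∈-++⁺ˡ (∈-map⁺ (k ,_) (∈-bitVecs s v))
  ... | no  k≢K  = ∈-++⁺ʳ (List.map (K ,_) (bitVecs s)) (<⇒∈-codes K (k , v) (≤∧≢⇒< (≤-pred k<1+K) k≢K))

  cardinality : HasCard (R s) (2 ^ (s + 1) * s)
  cardinality = List.map encode (codes 2s) , length-elements ,
    Unique-mapOn⁺ encode (encode-injective _ _) (All.tabulate (∈-codes⇒< 2s)) (codes-unique 2s) ,
    λ x → mk⇔ (λ x∈R → ∈-elements (R⇒Encoded x∈R)) (λ x∈ → elements-∈R (∈-map⁻ encode x∈))
    where
    length-elements : length (List.map encode (codes 2s)) ≡ 2 ^ (s + 1) * s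
    length-elements = begin
      length (List.map encode (codes 2s))  ≡⟨ length-map encode (codes 2s) ⟩
      length (codes 2s)                    ≡⟨ length-codes 2s ⟩
      (2 * s) * 2 ^ s                      ≡⟨ lemma (2 ^ s) s ⟩
      2 ^ (1 + s) * s                      ≡⟨ cong (λ n → 2 ^ n * s) (+-comm 1 s) ⟩
      2 ^ (s + 1) * s                      ∎
      where
      open ≡-Reasoning
      lemma : ∀ x s → (2 * s) * x ≡ (2 * x) * s
      lemma = solve-∀
    ∈-elements : ∀ {x} → Encoded x → x ∈ List.map encode (codes 2s)
    ∈-elements (m , m-valid , refl) = ∈-map⁺ encode (<⇒∈-codes 2s m m-valid)
    elements-∈R : ∀ {x} → ∃ (λ m → m ∈ codes 2s × x ≡ encode m) → R s x
    elements-∈R (m , m∈ , refl) = encode∈R m (∈-codes⇒< 2s m∈)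

  _⊞_ : ℕ → ℕ → ℕ
  k ⊞ d = if k + d <ᵇ 2s then k + d else k + d ∸ 2s

  ⊞-lo : ∀ k d → k + d < 2s → k ⊞ d ≡ k + d
  ⊞-lo k d lt = if-true (<ᵇ-true lt)

  ⊞-hi : ∀ k d → ¬ k + d < 2s → k ⊞ d ≡ k + d ∸ 2s
  ⊞-hi k d ≮ = if-false (<ᵇ-false ≮)

  ⊞-hi+2s : ∀ k d → ¬ k + d < 2s → k ⊞ d + 2s ≡ k + d
  ⊞-hi+2s k d ≮ = trans (cong (_+ 2s) (⊞-hi k d ≮)) (m∸n+n≡m (≮⇒≥ ≮))

  ⊞-cancelˡ : ∀ k d d′ → d < 2s → d′ < 2s → k ⊞ d ≡ k ⊞ d′ → d ≡ d′
  ⊞-cancelˡ k d d′ d<2s d′<2s eq with k + d <? 2s | k + d′ <? 2s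
  ... | yes lt | yes lt′ = +-cancelˡ-≡ k d d′ (trans (sym (⊞-lo k d lt)) (trans eq (⊞-lo k d′ lt′)))
  ... | no ≮   | no ≮′   = +-cancelˡ-≡ k d d′ (trans (sym (⊞-hi+2s k d ≮)) (trans (cong (_+ 2s) eq) (⊞-hi+2s k d′ ≮′)))
  ... | yes lt | no ≮′   = ⊥-elim (<⇒≱ d′<2s (subst (2s ≤_) (sym d′≡d+2s) (m≤n+m 2s d)))
    where
    d′≡d+2s : d′ ≡ d + 2s
    d′≡d+2s = +-cancelˡ-≡ k d′ (d + 2s)
      (trans (sym (⊞-hi+2s k d′ ≮′)) (trans (cong (_+ 2s) (trans (sym eq) (⊞-lo k d lt))) (+-assoc k d 2s)))
  ... | no ≮   | yes lt′ = ⊥-elim (<⇒≱ d<2s (subst (2s ≤_) (sym d≡d′+2s) (m≤n+m 2s d′)))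
    where
    d≡d′+2s : d ≡ d′ + 2s
    d≡d′+2s = +-cancelˡ-≡ k d (d′ + 2s)
      (trans (sym (⊞-hi+2s k d ≮)) (trans (cong (_+ 2s) (trans eq (⊞-lo k d′ lt′))) (+-assoc k d′ 2s)))

  suc-⊞ : ∀ k d → suc k ⊞ d ≡ k ⊞ suc d
  suc-⊞ k d = cong (λ x → if x <ᵇ 2s then x else x ∸ 2s) (sym (+-suc k d))

  0⊞ : ∀ k d → suc k ≡ 2s → d < 2s → 0 ⊞ d ≡ k ⊞ suc d
  0⊞ k d 1+k≡2s d<2s = trans (⊞-lo 0 d d<2s) (sym (trans (⊞-hi k (suc d) ≮) (trans (cong (_∸ 2s) k+1+d≡) (m+n∸m≡n 2s d))))
    where
    k+1+d≡ : k + suc d ≡ 2s + d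
    k+1+d≡ = trans (+-suc k d) (cong (_+ d) 1+k≡2s)
    ≮ : ¬ k + suc d < 2s
    ≮ lt = <⇒≱ lt (subst (2s ≤_) (sym k+1+d≡) (m≤m+n 2s d))

  ⊞-identityʳ : ∀ k → k < 2s → k ⊞ 0 ≡ k
  ⊞-identityʳ k k<2s = trans (⊞-lo k 0 (subst (_< 2s) (sym (+-identityʳ k)) k<2s)) (+-identityʳ k)

  mulB-⊞ : ∀ k w → k < 2s → ∀ d → suc d < 2s → proj₁ (mulB (k , w)) ⊞ d ≡ k ⊞ suc d
  mulB-⊞ k w k<2s d 1+d<2s with m≤n⇒m<n∨m≡n k<2s
  ... | inj₁ 1+k<2s rewrite mulB-inner k w 1+k<2s = suc-⊞ k d
  ... | inj₂ 1+k≡2s rewrite mulB-wrap k w 1+k≡2s = 0⊞ k d 1+k≡2s (<-trans (n<1+n d) 1+d<2s)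

  mulB-⊞-last : ∀ k w → k < 2s → proj₁ (mulB (k , w)) ⊞ 2s-1 ≡ k ⊞ 0
  mulB-⊞-last k w k<2s with m≤n⇒m<n∨m≡n k<2s
  ... | inj₁ 1+k<2s rewrite mulB-inner k w 1+k<2s = begin
    suc k ⊞ 2s-1   ≡⟨ suc-⊞ k 2s-1 ⟩
    k ⊞ suc 2s-1   ≡⟨ cong (k ⊞_) 2s≡1+2s-1 ⟨
    k ⊞ 2s         ≡⟨ ⊞-hi k 2s (λ lt → <-irrefl refl (≤-<-trans (m≤n+m 2s k) lt)) ⟩
    k + 2s ∸ 2s    ≡⟨ m+n∸n≡m k 2s ⟩
    k              ≡⟨ ⊞-identityʳ k k<2s ⟨
    k ⊞ 0          ∎
    where open ≡-Reasoning
  ... | inj₂ 1+k≡2s rewrite mulB-wrap k w 1+k≡2s =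
    trans (⊞-lo 0 2s-1 2s-1<2s) (trans (sym (suc-injective (trans 1+k≡2s 2s≡1+2s-1))) (sym (⊞-identityʳ k k<2s)))

  twist : (ℕ → Bool) → Code → Code
  twist J (k , v) = (k , tabulateℕ s (λ i → at v i xor J (k ⊞ i)))

  at-twist : ∀ J k v i → i < s → at (proj₂ (twist J (k , v))) i ≡ at v i xor J (k ⊞ i)
  at-twist J k v = at-tabulateℕ s (λ i → at v i xor J (k ⊞ i))

  twist-involutive : ∀ J m → twist J (twist J m) ≡ m
  twist-involutive J (k , v) = cong (k ,_) (at-ext _ _ λ i i<s →
    trans (at-twist J k (proj₂ (twist J (k , v))) i i<s)
          (trans (cong (_xor J (k ⊞ i)) (at-twist J k v i i<s)) (xor-cancelʳ (at v i) (J (k ⊞ i)))))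

  _⊕_ : (ℕ → Bool) → (ℕ → Bool) → (ℕ → Bool)
  (J₁ ⊕ J₂) q = J₁ q xor J₂ q

  twist-⊕ : ∀ J₁ J₂ m → twist (J₁ ⊕ J₂) m ≡ twist J₂ (twist J₁ m)
  twist-⊕ J₁ J₂ (k , v) = cong (k ,_) (at-ext _ _ λ i i<s → begin
    at (proj₂ (twist (J₁ ⊕ J₂) (k , v))) i         ≡⟨ at-twist (J₁ ⊕ J₂) k v i i<s ⟩
    at v i xor (J₁ (k ⊞ i) xor J₂ (k ⊞ i))         ≡⟨ xor-assoc (at v i) (J₁ (k ⊞ i)) (J₂ (k ⊞ i)) ⟨
    (at v i xor J₁ (k ⊞ i)) xor J₂ (k ⊞ i)         ≡⟨ cong (_xor J₂ (k ⊞ i)) (at-twist J₁ k v i i<s) ⟨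
    at (proj₂ (twist J₁ (k , v))) i xor J₂ (k ⊞ i) ≡⟨ at-twist J₂ k (proj₂ (twist J₁ (k , v))) i i<s ⟨
    at (proj₂ (twist J₂ (twist J₁ (k , v)))) i     ∎)
    where open ≡-Reasoning

  twist-trivial : ∀ J k v → (∀ d → d < s → J (k ⊞ d) ≡ false) → twist J (k , v) ≡ (k , v)
  twist-trivial J k v J≡false = cong (k ,_) (at-ext _ _ λ i i<s →
    trans (at-twist J k v i i<s) (trans (cong (at v i xor_) (J≡false i i<s)) (xor-identityʳ (at v i))))

  at-flipIf : ∀ c k w i → i < s → at (proj₂ (flipIf c (k , w))) i ≡ at w i xor (c ∧ (i ≡ᵇ 0))
  at-flipIf true  k w i i<s = at-flipAt 0 w i i<s
  at-flipIf false k w i i<s = sym (xor-identityʳ (at w i))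

  flipIf-pair : ∀ c k w → flipIf c (k , w) ≡ (k , proj₂ (flipIf c (k , w)))
  flipIf-pair true  k w = refl
  flipIf-pair false k w = refl

  twist-flipIf : ∀ J c m → twist J (flipIf c m) ≡ flipIf c (twist J m)
  twist-flipIf J false m       = refl
  twist-flipIf J true  (k , v) = cong (k ,_) (at-ext _ _ λ i i<s → begin
    at (proj₂ (twist J (flip0 (k , v)))) i         ≡⟨ at-twist J k (flipAt 0 v) i i<s ⟩
    at (flipAt 0 v) i xor J (k ⊞ i)                ≡⟨ cong (_xor J (k ⊞ i)) (at-flipAt 0 v i i<s) ⟩
    (at v i xor (i ≡ᵇ 0)) xor J (k ⊞ i)            ≡⟨ xor-swapʳ (at v i) (i ≡ᵇ 0) (J (k ⊞ i)) ⟩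
    (at v i xor J (k ⊞ i)) xor (i ≡ᵇ 0)            ≡⟨ cong (_xor (i ≡ᵇ 0)) (at-twist J k v i i<s) ⟨
    at (proj₂ (twist J (k , v))) i xor (i ≡ᵇ 0)    ≡⟨ at-flipAt 0 (proj₂ (twist J (k , v))) i i<s ⟨
    at (proj₂ (flip0 (twist J (k , v)))) i         ∎)
    where open ≡-Reasoning

  -- Twisting conjugates b into b or a b: the bit shifted out at column k re-enters at column k + s.

  twistFlip : (ℕ → Bool) → ℕ → Bool
  twistFlip J k = J (k ⊞ 0) xor J (k ⊞ s)

  at-rotate-twisted : ∀ J k v → k < 2s → ∀ i → i < s →
    at (rotate (proj₂ (flipIf (twistFlip J k) (twist J (k , v))))) i ≡ at (rotate v) i xor J (k ⊞ suc i)
  at-rotate-twisted J k v k<2s i i<s with m≤n⇒m<n∨m≡n i<s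
  ... | inj₁ 1+i<s = begin
    at (rotate w″) i                                                   ≡⟨ at-rotate w″ i 1+i<s ⟩
    at w″ (suc i)                                                      ≡⟨ at-flipIf c k w (suc i) 1+i<s ⟩
    at w (suc i) xor (c ∧ false)                                       ≡⟨ cong₂ _xor_ (at-twist J k v (suc i) 1+i<s) (∧-zeroʳ c) ⟩
    (at v (suc i) xor J (k ⊞ suc i)) xor false                         ≡⟨ xor-identityʳ _ ⟩
    at v (suc i) xor J (k ⊞ suc i)                                     ≡⟨ cong (_xor J (k ⊞ suc i)) (at-rotate v i 1+i<s) ⟨
    at (rotate v) i xor J (k ⊞ suc i)                                  ∎
    where
    open ≡-Reasoning
    c = twistFlip J k
    w = proj₂ (twist J (k , v))
    w″ = proj₂ (flipIf c (k , w))
  ... | inj₂ 1+i≡s with suc-injective 1+i≡s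
  ...   | refl = begin
    at (rotate w″) s-1                                                 ≡⟨ at-rotate-last w″ ⟩
    at w″ 0                                                            ≡⟨ at-flipIf c k w 0 (s≤s z≤n) ⟩
    at w 0 xor (c ∧ true)                                              ≡⟨ cong₂ _xor_ (at-twist J k v 0 (s≤s z≤n)) (∧-identityʳ c) ⟩
    (at v 0 xor J (k ⊞ 0)) xor (J (k ⊞ 0) xor J (k ⊞ s))               ≡⟨ xor-assoc (at v 0) (J (k ⊞ 0)) _ ⟩
    at v 0 xor (J (k ⊞ 0) xor (J (k ⊞ 0) xor J (k ⊞ s)))               ≡⟨ cong (at v 0 xor_) (xor-assoc (J (k ⊞ 0)) (J (k ⊞ 0)) (J (k ⊞ s))) ⟨
    at v 0 xor ((J (k ⊞ 0) xor J (k ⊞ 0)) xor J (k ⊞ s))               ≡⟨ cong (λ x → at v 0 xor (x xor J (k ⊞ s))) (xor-same (J (k ⊞ 0))) ⟩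
    at v 0 xor J (k ⊞ s)                                               ≡⟨ cong (_xor J (k ⊞ s)) (at-rotate-last v) ⟨
    at (rotate v) s-1 xor J (k ⊞ s)                                    ∎
    where
    open ≡-Reasoning
    c = twistFlip J k
    w = proj₂ (twist J (k , v))
    w″ = proj₂ (flipIf c (k , w))

  twist-mulB : ∀ J k v → k < 2s → twist J (mulB (k , v)) ≡ mulB (flipIf (twistFlip J k) (twist J (k , v)))
  twist-mulB J k v k<2s with m≤n⇒m<n∨m≡n k<2s
  ... | inj₁ 1+k<2s rewrite mulB-inner k v 1+k<2s | flipIf-pair (twistFlip J k) k (proj₂ (twist J (k , v)))
                          | mulB-inner k (proj₂ (flipIf (twistFlip J k) (twist J (k , v)))) 1+k<2s =
    cong (suc k ,_) (at-ext _ _ λ i i<s →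
      trans (at-twist J (suc k) (rotate v) i i<s)
            (trans (cong (at (rotate v) i xor_) (cong J (suc-⊞ k i))) (sym (at-rotate-twisted J k v k<2s i i<s))))
  ... | inj₂ 1+k≡2s rewrite mulB-wrap k v 1+k≡2s | flipIf-pair (twistFlip J k) k (proj₂ (twist J (k , v)))
                          | mulB-wrap k (proj₂ (flipIf (twistFlip J k) (twist J (k , v)))) 1+k≡2s =
    cong (0 ,_) (at-ext _ _ λ i i<s → begin
      at (proj₂ (twist J (0 , complement (rotate v)))) i     ≡⟨ at-twist J 0 (complement (rotate v)) i i<s ⟩
      at (complement (rotate v)) i xor J (0 ⊞ i)             ≡⟨ cong₂ _xor_ (at-complement (rotate v) i i<s) (cong J (0⊞ k i 1+k≡2s (<-≤-trans i<s s≤2s))) ⟩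
      not (at (rotate v) i) xor J (k ⊞ suc i)                ≡⟨ not-distribˡ-xor (at (rotate v) i) _ ⟨
      not (at (rotate v) i xor J (k ⊞ suc i))                ≡⟨ cong not (at-rotate-twisted J k v k<2s i i<s) ⟨
      not (at (rotate w″) i)                                 ≡⟨ at-complement (rotate w″) i i<s ⟨
      at (complement (rotate w″)) i                          ∎)
    where
    open ≡-Reasoning
    w″ = proj₂ (flipIf (twistFlip J k) (twist J (k , v)))

  twist-successor : ∀ J c k v → k < 2s → twist J (successor c (k , v)) ≡ successor (twistFlip J k xor c) (twist J (k , v))
  twist-successor J c k v k<2s = begin
    twist J (mulB (flipIf c (k , v)))                                ≡⟨ cong (λ m → twist J (mulB m)) (flipIf-pair c k v) ⟩
    twist J (mulB (k , proj₂ (flipIf c (k , v))))                   ≡⟨ twist-mulB J k (proj₂ (flipIf c (k , v))) k<2s ⟩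
    mulB (flipIf (twistFlip J k) (twist J (k , proj₂ (flipIf c (k , v))))) ≡⟨ cong (λ m → mulB (flipIf (twistFlip J k) (twist J m))) (flipIf-pair c k v) ⟨
    mulB (flipIf (twistFlip J k) (twist J (flipIf c (k , v))))      ≡⟨ cong (λ m → mulB (flipIf (twistFlip J k) m)) (twist-flipIf J c (k , v)) ⟩
    mulB (flipIf (twistFlip J k) (flipIf c (twist J (k , v))))      ≡⟨ cong mulB (flipIf-flipIf (twistFlip J k) c (twist J (k , v))) ⟩
    mulB (flipIf (twistFlip J k xor c) (twist J (k , v)))           ∎
    where open ≡-Reasoning

  twistPerm : (ℕ → Bool) → Perm (4 * s) → Perm (4 * s)
  twistPerm J x = encode (twist J (decode x))

  twistPerm-encode : ∀ J m → Valid m → twistPerm J (encode m) ≡ encode (twist J m)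
  twistPerm-encode J m m-valid = cong (λ m′ → encode (twist J m′)) (decode-encode m m-valid)

  twist-arc : ∀ J m m′ → Valid m → Valid m′ → ΓArc s (encode m) (encode m′) → ΓArc s (encode (twist J m)) (encode (twist J m′))
  twist-arc J (k , v) m′ k<2s m′-valid arc = Successor⇒arc (twist J (k , v)) k<2s (twisted (arc⇒Successor (k , v) k<2s arc))
    where
    twisted : Successor (k , v) (encode m′) → Successor (twist J (k , v)) (encode (twist J m′))
    twisted (c , eq) = twistFlip J k xor c , cong encode (trans (cong (twist J) m′≡) (twist-successor J c k v k<2s))
      where
      m′≡ : m′ ≡ successor c (k , v)
      m′≡ = encode-injective m′ _ m′-valid (successor-valid c (k , v) k<2s) eq

  twistAut : (ℕ → Bool) → Automorphism (R s) (ΓArc s)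
  twistAut J = record
    { f = twistPerm J ; g = twistPerm J ; f-V = ∈R ; g-V = ∈R ; gf = involutive ; fg = involutive
    ; f-arc = λ x y x∈R y∈R → preserves (R⇒Encoded x∈R) (R⇒Encoded y∈R) }
    where
    ∈R : ∀ x → R s x → R s (twistPerm J x)
    ∈R x x∈R = encoded-∈R (R⇒Encoded x∈R)
      where
      encoded-∈R : ∀ {x} → Encoded x → R s (twistPerm J x)
      encoded-∈R (m , m-valid , refl) = subst (R s) (sym (twistPerm-encode J m m-valid)) (encode∈R (twist J m) m-valid)
    involutive : ∀ x → R s x → twistPerm J (twistPerm J x) ≡ x
    involutive x x∈R = encoded-involutive (R⇒Encoded x∈R)
      where
      encoded-involutive : ∀ {x} → Encoded x → twistPerm J (twistPerm J x) ≡ x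
      encoded-involutive (m , m-valid , refl) = trans (cong (twistPerm J) (twistPerm-encode J m m-valid))
        (trans (twistPerm-encode J (twist J m) m-valid) (cong encode (twist-involutive J m)))
    preserves : ∀ {x y} → Encoded x → Encoded y → ΓArc s x y ⇔ ΓArc s (twistPerm J x) (twistPerm J y)
    preserves (m , m-valid , refl) (m′ , m′-valid , refl) = mk⇔
      (λ arc → subst₂ (ΓArc s) (sym (twistPerm-encode J m m-valid)) (sym (twistPerm-encode J m′ m′-valid))
                 (twist-arc J m m′ m-valid m′-valid arc))
      (λ arc → subst₂ (ΓArc s) (cong encode (twist-involutive J m)) (cong encode (twist-involutive J m′))
                 (twist-arc J (twist J m) (twist J m′) m-valid m′-valid
                   (subst₂ (ΓArc s) (twistPerm-encode J m m-valid) (twistPerm-encode J m′ m′-valid) arc)))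

  arc⇔generator : ∀ {x y} → Encoded x → ΓArc s x y ⇔ Σ Bool (λ c → y ≡ generator c · x)
  arc⇔generator (m , m-valid , refl) = mk⇔
    (λ arc → let (c , eq) = arc⇒Successor m m-valid arc in c , trans eq (sym (generator·encode c m m-valid)))
    (λ (c , eq) → Successor⇒arc m m-valid (c , trans eq (generator·encode c m m-valid)))

  -- The arcs x → g x of a Cayley digraph are preserved by right multiplications.
  rightMulAut : ∀ h h⁻¹ → Encoded h → Encoded h⁻¹ → h · h⁻¹ ≡ idP → h⁻¹ · h ≡ idP → Automorphism (R s) (ΓArc s)
  rightMulAut h h⁻¹ h-encoded h⁻¹-encoded h·h⁻¹≡id h⁻¹·h≡id = record
    { f = _· h ; g = _· h⁻¹
    ; f-V = λ x x∈R → Encoded⇒R (Encoded-· (R⇒Encoded x∈R) h-encoded)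
    ; g-V = λ x x∈R → Encoded⇒R (Encoded-· (R⇒Encoded x∈R) h⁻¹-encoded)
    ; gf = λ x _ → ·-cancelʳ x h h⁻¹ h·h⁻¹≡id
    ; fg = λ x _ → ·-cancelʳ x h⁻¹ h h⁻¹·h≡id
    ; f-arc = λ x y x∈R _ → preserves (R⇒Encoded x∈R)
    }
    where
    ·h : ∀ {x y} c → y ≡ generator c · x → y · h ≡ generator c · (x · h)
    ·h {x} c refl = ·-assoc (generator c) x h
    preserves : ∀ {x y} → Encoded x → ΓArc s x y ⇔ ΓArc s (x · h) (y · h)
    preserves {x} {y} x-encoded = mk⇔
      (λ arc → let (c , eq) = Equivalence.to (arc⇔generator x-encoded) arc in
        Equivalence.from (arc⇔generator xh-encoded) (c , ·h {x} {y} c eq))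
      (λ arc → let (c , eq) = Equivalence.to (arc⇔generator xh-encoded) arc in
        Equivalence.from (arc⇔generator x-encoded) (c , (begin
          y                          ≡⟨ ·-cancelʳ y h h⁻¹ h·h⁻¹≡id ⟨
          (y · h) · h⁻¹              ≡⟨ cong (_· h⁻¹) eq ⟩
          (generator c · (x · h)) · h⁻¹ ≡⟨ ·-assoc (generator c) (x · h) h⁻¹ ⟩
          generator c · ((x · h) · h⁻¹) ≡⟨ cong (generator c ·_) (·-cancelʳ x h h⁻¹ h·h⁻¹≡id) ⟩
          generator c · x            ∎)))
      where
      open ≡-Reasoning
      xh-encoded = Encoded-· x-encoded h-encoded

  arc-endpoints : ∀ {x y} → ΓArc s x y → R s x × R s y
  arc-endpoints arc = proj₁ arc , proj₁ (proj₂ arc)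

  ArcSeq : ∀ {k} → Vec (Perm (4 * s)) (suc k) → Set
  ArcSeq = IsArcSeq (R s) (ΓArc s)

  twistPerm-⊕ : ∀ J₁ J₂ x → R s x → twistPerm (J₁ ⊕ J₂) x ≡ twistPerm J₂ (twistPerm J₁ x)
  twistPerm-⊕ J₁ J₂ x x∈R = encoded (R⇒Encoded x∈R)
    where
    encoded : ∀ {x} → Encoded x → twistPerm (J₁ ⊕ J₂) x ≡ twistPerm J₂ (twistPerm J₁ x)
    encoded (m , m-valid , refl) = begin
      twistPerm (J₁ ⊕ J₂) (encode m)          ≡⟨ twistPerm-encode (J₁ ⊕ J₂) m m-valid ⟩
      encode (twist (J₁ ⊕ J₂) m)              ≡⟨ cong encode (twist-⊕ J₁ J₂ m) ⟩
      encode (twist J₂ (twist J₁ m))          ≡⟨ twistPerm-encode J₂ (twist J₁ m) m-valid ⟨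
      twistPerm J₂ (encode (twist J₁ m))      ≡⟨ cong (twistPerm J₂) (twistPerm-encode J₁ m m-valid) ⟨
      twistPerm J₂ (twistPerm J₁ (encode m))  ∎
      where open ≡-Reasoning

  SupportedIn : (ℕ → Bool) → ℕ → ℕ → Set
  SupportedIn J k₀ k = (∀ d → d < s → J (k₀ ⊞ d) ≡ false) × (∀ d → s + k ≤ d → d < 2s → J (k₀ ⊞ d) ≡ false)

  column : Bool → ℕ → (ℕ → Bool)
  column c q₀ q = c ∧ (q ≡ᵇ q₀)

  column-off : ∀ c k₀ d → d < 2s → d ≢ s → column c (k₀ ⊞ s) (k₀ ⊞ d) ≡ false
  column-off c k₀ d d<2s d≢s = trans (cong (c ∧_) (≡ᵇ-false (λ eq → d≢s (⊞-cancelˡ k₀ d s d<2s s<2s eq)))) (∧-zeroʳ c)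

  column-on : ∀ c q₀ → column c q₀ q₀ ≡ c
  column-on c q₀ = trans (cong (c ∧_) (≡ᵇ-true {q₀} refl)) (∧-identityʳ c)

  twist-column-fixes : ∀ c k₀ v₀ → twist (column c (k₀ ⊞ s)) (k₀ , v₀) ≡ (k₀ , v₀)
  twist-column-fixes c k₀ v₀ = twist-trivial (column c (k₀ ⊞ s)) k₀ v₀ λ d d<s → column-off c k₀ d (<-≤-trans d<s s≤2s) (<⇒≢ d<s)

  twist-column-successor : ∀ cγ cβ k₀ v₀ → k₀ < 2s →
    twist (column (cγ xor cβ) (k₀ ⊞ s)) (successor cγ (k₀ , v₀)) ≡ successor cβ (k₀ , v₀)
  twist-column-successor cγ cβ k₀ v₀ k₀<2s = begin
    twist J (successor cγ (k₀ , v₀))                     ≡⟨ twist-successor J cγ k₀ v₀ k₀<2s ⟩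
    successor (twistFlip J k₀ xor cγ) (twist J (k₀ , v₀)) ≡⟨ cong₂ successor (cong (_xor cγ) twistFlip≡) (twist-column-fixes (cγ xor cβ) k₀ v₀) ⟩
    successor ((cγ xor cβ) xor cγ) (k₀ , v₀)             ≡⟨ cong (λ c → successor c (k₀ , v₀)) (xor-cancelˡ cγ cβ) ⟩
    successor cβ (k₀ , v₀)                               ∎
    where
    open ≡-Reasoning
    J = column (cγ xor cβ) (k₀ ⊞ s)
    twistFlip≡ : twistFlip J k₀ ≡ cγ xor cβ
    twistFlip≡ = cong₂ _xor_ (column-off (cγ xor cβ) k₀ 0 (s≤s z≤n) (λ ())) (column-on (cγ xor cβ) (k₀ ⊞ s))

  SupportedIn-step : ∀ c J k₀ w k → k₀ < 2s → k < s →
    SupportedIn J (proj₁ (mulB (k₀ , w))) k → SupportedIn (column c (k₀ ⊞ s) ⊕ J) k₀ (suc k)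
  SupportedIn-step c J k₀ w k k₀<2s k<s (J-low , J-high) = low , high
    where
    k₁ = proj₁ (mulB (k₀ , w))
    s+k≤2s-1 : s + k ≤ 2s-1
    s+k≤2s-1 = subst (s + k ≤_) (sym 2s-1≡s+s-1) (+-monoʳ-≤ s (≤-pred k<s))
    low : ∀ d → d < s → (column c (k₀ ⊞ s) ⊕ J) (k₀ ⊞ d) ≡ false
    low zero    _        = cong₂ _xor_ (column-off c k₀ 0 (s≤s z≤n) (λ ()))
      (trans (cong J (sym (mulB-⊞-last k₀ w k₀<2s))) (J-high 2s-1 s+k≤2s-1 2s-1<2s))
    low (suc d) 1+d<s    = cong₂ _xor_ (column-off c k₀ (suc d) (<-≤-trans 1+d<s s≤2s) (<⇒≢ 1+d<s))
      (trans (cong J (sym (mulB-⊞ k₀ w k₀<2s d (<-≤-trans 1+d<s s≤2s)))) (J-low d (<-trans (n<1+n d) 1+d<s)))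
    high : ∀ d → s + suc k ≤ d → d < 2s → (column c (k₀ ⊞ s) ⊕ J) (k₀ ⊞ d) ≡ false
    high zero    s+1+k≤0 _ = ⊥-elim (<⇒≱ (≤-trans (s≤s z≤n) (m≤m+n s (suc k))) s+1+k≤0)
    high (suc d) s+1+k≤1+d 1+d<2s = cong₂ _xor_
      (column-off c k₀ (suc d) 1+d<2s (λ eq → <⇒≱ (m<m+n s {suc k} (s≤s z≤n)) (subst (s + suc k ≤_) eq s+1+k≤1+d)))
      (trans (cong J (sym (mulB-⊞ k₀ w k₀<2s d 1+d<2s)))
             (J-high d (≤-pred (subst (_≤ suc d) (+-suc s k) s+1+k≤1+d)) (<-trans (n<1+n d) 1+d<2s)))

  -- Two k-arcs (k ≤ s) with the same initial vertex are matched by a twist: at each step the choice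
  -- between b and a b is a single bit, corrected by twisting the column k₀ + s + i.
  mutual
    twist-matching-arcs : ∀ k → k ≤ s → ∀ k₀ v₀ → k₀ < 2s → (γ β : Vec (Perm (4 * s)) k) →
      ArcSeq (encode (k₀ , v₀) ∷ γ) → ArcSeq (encode (k₀ , v₀) ∷ β) →
      Σ (ℕ → Bool) (λ J → SupportedIn J k₀ k × Vec.map (twistPerm J) (encode (k₀ , v₀) ∷ γ) ≡ encode (k₀ , v₀) ∷ β)
    twist-matching-arcs zero _ k₀ v₀ k₀<2s [] [] _ _ = (λ _ → false) , ((λ _ _ → refl) , (λ _ _ _ → refl)) ,
      cong (_∷ []) (trans (twistPerm-encode (λ _ → false) (k₀ , v₀) k₀<2s) (cong encode (twist-trivial (λ _ → false) k₀ v₀ λ _ _ → refl)))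
    twist-matching-arcs (suc k) 1+k≤s k₀ v₀ k₀<2s (γ₁ ∷ γs) (β₁ ∷ βs) (cons arcγ arcsγ) (cons arcβ arcsβ) =
      twist-matching-successors k 1+k≤s k₀ v₀ k₀<2s γs βs (arc⇒Successor (k₀ , v₀) k₀<2s arcγ) (arc⇒Successor (k₀ , v₀) k₀<2s arcβ) arcsγ arcsβ

    twist-matching-successors : ∀ k → suc k ≤ s → ∀ k₀ v₀ → k₀ < 2s → ∀ {γ₁ β₁} (γs βs : Vec (Perm (4 * s)) k) →
      Successor (k₀ , v₀) γ₁ → Successor (k₀ , v₀) β₁ → ArcSeq (γ₁ ∷ γs) → ArcSeq (β₁ ∷ βs) →
      Σ (ℕ → Bool) (λ J → SupportedIn J k₀ (suc k) × Vec.map (twistPerm J) (encode (k₀ , v₀) ∷ γ₁ ∷ γs) ≡ encode (k₀ , v₀) ∷ β₁ ∷ βs)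
    twist-matching-successors k 1+k≤s k₀ v₀ k₀<2s γs βs (cγ , refl) (cβ , refl) arcsγ arcsβ =
      J₁ ⊕ J₂ , J-supported , cong₂ _∷_ fixes-m₀ (begin
        Vec.map (twistPerm (J₁ ⊕ J₂)) (encode (successor cγ m₀) ∷ γs)
          ≡⟨ IsArcSeq-map-cong arc-endpoints arcsγ _ _ (twistPerm-⊕ J₁ J₂) ⟩
        Vec.map (λ x → twistPerm J₂ (twistPerm J₁ x)) (encode (successor cγ m₀) ∷ γs)
          ≡⟨ map-∘ (twistPerm J₂) (twistPerm J₁) (encode (successor cγ m₀) ∷ γs) ⟩
        Vec.map (twistPerm J₂) (twistPerm J₁ (encode (successor cγ m₀)) ∷ Vec.map (twistPerm J₁) γs)
          ≡⟨ cong (λ x → Vec.map (twistPerm J₂) (x ∷ Vec.map (twistPerm J₁) γs)) twist-γ₁ ⟩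
        Vec.map (twistPerm J₂) (encode m₁ ∷ Vec.map (twistPerm J₁) γs)
          ≡⟨ proj₂ (proj₂ recursion) ⟩
        encode m₁ ∷ βs ∎)
      where
      open ≡-Reasoning
      m₀ : Code
      m₀ = (k₀ , v₀)
      J₁ : ℕ → Bool
      J₁ = column (cγ xor cβ) (k₀ ⊞ s)
      m₁ : Code
      m₁ = successor cβ m₀
      twist-γ₁ : twistPerm J₁ (encode (successor cγ m₀)) ≡ encode m₁
      twist-γ₁ = trans (twistPerm-encode J₁ (successor cγ m₀) (successor-valid cγ m₀ k₀<2s))
                       (cong encode (twist-column-successor cγ cβ k₀ v₀ k₀<2s))
      arcsγ′ : ArcSeq (encode m₁ ∷ Vec.map (twistPerm J₁) γs)
      arcsγ′ = subst (λ x → ArcSeq (x ∷ Vec.map (twistPerm J₁) γs)) twist-γ₁ (IsArcSeq-map arc-endpoints (twistAut J₁) arcsγ)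
      recursion : Σ (ℕ → Bool) (λ J → SupportedIn J (proj₁ m₁) k ×
                    Vec.map (twistPerm J) (encode m₁ ∷ Vec.map (twistPerm J₁) γs) ≡ encode m₁ ∷ βs)
      recursion = twist-matching-arcs k (≤-trans (n≤1+n k) 1+k≤s) (proj₁ m₁) (proj₂ m₁) (successor-valid cβ m₀ k₀<2s)
                    (Vec.map (twistPerm J₁) γs) βs arcsγ′ arcsβ
      J₂ : ℕ → Bool
      J₂ = proj₁ recursion
      J-supported : SupportedIn (J₁ ⊕ J₂) k₀ (suc k)
      J-supported = SupportedIn-step (cγ xor cβ) J₂ k₀ (proj₂ (flipIf cβ m₀)) k k₀<2s 1+k≤s
        (subst (λ m → SupportedIn J₂ (proj₁ (mulB m)) k) (flipIf-pair cβ k₀ v₀) (proj₁ (proj₂ recursion)))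
      fixes-m₀ : twistPerm (J₁ ⊕ J₂) (encode m₀) ≡ encode m₀
      fixes-m₀ = trans (twistPerm-encode (J₁ ⊕ J₂) m₀ k₀<2s) (cong encode (twist-trivial (J₁ ⊕ J₂) k₀ v₀ (proj₁ J-supported)))

  arcTransitive : ArcTransitive (R s) (ΓArc s) s
  arcTransitive (x₀ ∷ αs) (y₀ ∷ βs) arcsα arcsβ = Automorphism-∘ (twistAut J) φ , map≡
    where
    x₀-inverse = Encoded-inverse (R⇒Encoded (IsArcSeq-head arc-endpoints arcsα))
    y₀-encoded = R⇒Encoded (IsArcSeq-head arc-endpoints arcsβ)
    r = proj₁ x₀-inverse
    h = r · y₀
    h-encoded = Encoded-· (proj₁ (proj₂ x₀-inverse)) y₀-encoded
    h-inverse = Encoded-inverse h-encoded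
    φ = rightMulAut h (proj₁ h-inverse) h-encoded (proj₁ (proj₂ h-inverse))
                    (proj₂ (proj₂ (proj₂ h-inverse))) (proj₁ (proj₂ (proj₂ h-inverse)))
    m₀ = proj₁ y₀-encoded
    y₀≡ = proj₂ (proj₂ y₀-encoded)
    x₀·h≡ : x₀ · h ≡ encode m₀
    x₀·h≡ = begin
      x₀ · (r · y₀)   ≡⟨ ·-assoc x₀ r y₀ ⟨
      (x₀ · r) · y₀   ≡⟨ cong (_· y₀) (proj₂ (proj₂ (proj₂ x₀-inverse))) ⟩
      idP · y₀        ≡⟨ ·-identityˡ y₀ ⟩
      y₀              ≡⟨ y₀≡ ⟩
      encode m₀       ∎
      where open ≡-Reasoning
    γs = Vec.map (_· h) αs
    arcsγ : ArcSeq (encode m₀ ∷ γs)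
    arcsγ = subst (λ x → ArcSeq (x ∷ γs)) x₀·h≡ (IsArcSeq-map arc-endpoints φ arcsα)
    matching = twist-matching-arcs s ≤-refl (proj₁ m₀) (proj₂ m₀) (proj₁ (proj₂ y₀-encoded)) γs βs arcsγ
                 (subst (λ x → ArcSeq (x ∷ βs)) y₀≡ arcsβ)
    J = proj₁ matching
    map≡ : Vec.map (λ x → twistPerm J (x · h)) (x₀ ∷ αs) ≡ y₀ ∷ βs
    map≡ = begin
      Vec.map (λ x → twistPerm J (x · h)) (x₀ ∷ αs)   ≡⟨ map-∘ (twistPerm J) (_· h) (x₀ ∷ αs) ⟩
      Vec.map (twistPerm J) (x₀ · h ∷ γs)             ≡⟨ cong (λ x → Vec.map (twistPerm J) (x ∷ γs)) x₀·h≡ ⟩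
      Vec.map (twistPerm J) (encode m₀ ∷ γs)          ≡⟨ proj₂ (proj₂ matching) ⟩
      encode m₀ ∷ βs                                  ≡⟨ cong (_∷ βs) y₀≡ ⟨
      y₀ ∷ βs                                         ∎
      where open ≡-Reasoning

  Successor? : ∀ m y → Dec (Successor m y)
  Successor? m y with ≡-dec Finₚ._≟_ y (encode (successor true m)) | ≡-dec Finₚ._≟_ y (encode (successor false m))
  ... | yes y≡ | _      = yes (true , y≡)
  ... | no _   | yes y≡ = yes (false , y≡)
  ... | no y≢₁ | no y≢₂ = no λ { (true , y≡) → y≢₁ y≡ ; (false , y≡) → y≢₂ y≡ }

  arc? : ∀ {x} → Encoded x → ∀ y → Dec (ΓArc s x y)
  arc? (m , m-valid , refl) y = map′ (Successor⇒arc m m-valid) (arc⇒Successor m m-valid) (Successor? m y)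

  mulA-exchange : ∀ c m w → w ≡ flipIf c (mulA m) → mulA w ≡ flipIf c m
  mulA-exchange c m w w≡ = trans (cong mulA w≡) (trans (mulA-flipIf c (mulA m)) (cong (flipIf c) (mulA-involutive m)))

  Successor-mulA⇒ : ∀ m w → Valid m → Valid w → Successor (mulA m) (encode (mulB w)) → Successor m (encode (mulB (mulA w)))
  Successor-mulA⇒ m w m-valid w-valid (c , eq) = c , cong (λ m′ → encode (mulB m′))
    (mulA-exchange c m w (successor-injective false c w (mulA m) w-valid m-valid eq))

  Successor-mulA⇐ : ∀ m w → Valid m → Valid w → Successor m (encode (mulB (mulA w))) → Successor (mulA m) (encode (mulB w))
  Successor-mulA⇐ m w m-valid w-valid (c , eq) = c , cong (λ m′ → encode (mulB m′))
    (trans (sym (mulA-involutive w)) (mulA-exchange c (mulA m) (mulA w)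
      (trans (successor-injective false c (mulA w) m w-valid m-valid eq) (cong (flipIf c) (sym (mulA-involutive m))))))

  -- The out-neighbours of encode m are encode (mulA m′) and encode m′ for m′ = mulB m, and a exchanges
  -- their arcs into the images of b and b a.
  arc-mulA⇔ : ∀ m w → Valid m → Valid w → ΓArc s (encode (mulA m)) (encode (mulB w)) ⇔ ΓArc s (encode m) (encode (mulB (mulA w)))
  arc-mulA⇔ m w m-valid w-valid = mk⇔
    (λ arc → Successor⇒arc m m-valid (Successor-mulA⇒ m w m-valid w-valid (arc⇒Successor (mulA m) m-valid arc)))
    (λ arc → Successor⇒arc (mulA m) m-valid (Successor-mulA⇐ m w m-valid w-valid (arc⇒Successor m m-valid arc)))

  ¬arc-idCode-mulB-mulA : ¬ ΓArc s (encode idCode) (encode (mulB (mulA idCode)))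
  ¬arc-idCode-mulB-mulA arc = ¬successor (arc⇒Successor idCode idCode-valid arc)
    where
    bit-s-1 : ∀ c → at (proj₂ (flipIf c idCode)) s-1 ≡ false
    bit-s-1 c = trans (at-flipIf c 0 (proj₂ idCode) s-1 (n<1+n s-1))
      (trans (cong₂ _xor_ (at-tabulateℕ s (λ _ → false) s-1 (n<1+n s-1)) (cong (c ∧_) (≡ᵇ-false {s-1} {0} (λ ())))) (∧-zeroʳ c))
    mulA-bit-s-1 : at (proj₂ (mulA idCode)) s-1 ≡ true
    mulA-bit-s-1 = trans (at-flipAt s-1 (proj₂ idCode) s-1 (n<1+n s-1))
      (cong₂ _xor_ (at-tabulateℕ s (λ _ → false) s-1 (n<1+n s-1)) (≡ᵇ-true {s-1} refl))
    ¬successor : ¬ Successor idCode (encode (mulB (mulA idCode)))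
    ¬successor (c , eq) with trans (sym mulA-bit-s-1) (trans (cong (λ m → at (proj₂ m) s-1)
                               (successor-injective false c (mulA idCode) idCode idCode-valid idCode-valid eq)) (bit-s-1 c))
    ... | ()

  codeOf : ∀ {x} → R s x → Code
  codeOf x∈R = proj₁ (R⇒Encoded x∈R)

  codeOf-valid : ∀ {x} (x∈R : R s x) → Valid (codeOf x∈R)
  codeOf-valid x∈R = proj₁ (proj₂ (R⇒Encoded x∈R))

  encode-codeOf : ∀ {x} (x∈R : R s x) → x ≡ encode (codeOf x∈R)
  encode-codeOf x∈R = proj₂ (proj₂ (R⇒Encoded x∈R))

  successorOf : Bool → ∀ x → R s x → Perm (4 * s)
  successorOf c _ x∈R = encode (successor c (codeOf x∈R))

  successorOf∈R : ∀ c x x∈R → R s (successorOf c x x∈R)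
  successorOf∈R c _ x∈R = encode∈R _ (successor-valid c (codeOf x∈R) (codeOf-valid x∈R))

  arc-successorOf : ∀ c x x∈R → ΓArc s x (successorOf c x x∈R)
  arc-successorOf c x x∈R = subst (λ z → ΓArc s z (successorOf c x x∈R)) (sym (encode-codeOf x∈R))
    (arc-successor c (codeOf x∈R) (codeOf-valid x∈R))

  only-successorOf : ∀ x x∈R y → ΓArc s x y → y ≡ successorOf true x x∈R ⊎ y ≡ successorOf false x x∈R
  only-successorOf x x∈R y arc = successor-cases
    (arc⇒Successor (codeOf x∈R) (codeOf-valid x∈R) (subst (λ z → ΓArc s z y) (encode-codeOf x∈R) arc))
    where
    successor-cases : Successor (codeOf x∈R) y → y ≡ successorOf true x x∈R ⊎ y ≡ successorOf false x x∈R
    successor-cases (true  , eq) = inj₁ eq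
    successor-cases (false , eq) = inj₂ eq

  successorsOf-distinct : ∀ x x∈R → successorOf true x x∈R ≢ successorOf false x x∈R
  successorsOf-distinct _ x∈R = successors-distinct (codeOf x∈R) (codeOf-valid x∈R)

  successorOf-swaps : ∀ x x∈R w → Valid w →
    ΓArc s (successorOf true x x∈R) (encode (mulB w)) ⇔ ΓArc s (successorOf false x x∈R) (encode (mulB (mulA w)))
  successorOf-swaps x x∈R w w-valid =
    subst (λ z → ΓArc s z (encode (mulB w)) ⇔ ΓArc s (successorOf false x x∈R) (encode (mulB (mulA w))))
      (cong encode (mulA-mulB (codeOf x∈R) (codeOf-valid x∈R)))
      (arc-mulA⇔ (mulB (codeOf x∈R)) w (mulB-valid (codeOf x∈R) (codeOf-valid x∈R)) w-valid)

  nonDiagonalizable : ∀ {c ℓ} (K : AlgClosedChar0 c ℓ) → NonDiagonalizableOver K (R s) (ΓArc s)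
  nonDiagonalizable K l l-unique l-enumerates M M-adjacency =
    LinearAlgebra.¬Diagonalizable-swapped-in-arcs (AlgClosedChar0.field' K) (R s) (ΓArc s) l l-unique l-enumerates M M-adjacency
      (λ x y x∈R → arc? (R⇒Encoded x∈R) y) successorOf successorOf∈R successorsOf-distinct arc-successorOf only-successorOf
      B BA I (encode∈R _ (mulB-valid idCode idCode-valid)) (encode∈R _ (mulB-valid (mulA idCode) idCode-valid)) (encode∈R idCode idCode-valid)
      (λ x x∈R → successorOf-swaps x x∈R idCode idCode-valid)
      (λ x x∈R → subst (λ z → ΓArc s (successorOf true x x∈R) BA ⇔ ΓArc s (successorOf false x x∈R) (encode (mulB z)))
                   (mulA-involutive idCode) (successorOf-swaps x x∈R (mulA idCode) idCode-valid))
      (arc-successor false idCode idCode-valid) ¬arc-idCode-mulB-mulA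
    where
    I = encode idCode
    B = encode (mulB idCode)
    BA = encode (mulB (mulA idCode))

theorem3p3 : (s : ℕ) → 2 ≤ s →
    HasCard (R s) (2 ^ (s Data.Nat.+ 1) * s)
    × RegularOfValency (R s) (ΓArc s) 2
    × StronglyConnected (R s) (ΓArc s)
    × ArcTransitive (R s) (ΓArc s) s
    × ((K : AlgClosedChar0 0ℓ 0ℓ) → NonDiagonalizableOver K (R s) (ΓArc s))
theorem3p3 (suc (suc t)) (s≤s (s≤s z≤n)) = cardinality , regular , stronglyConnected , arcTransitive , nonDiagonalizable
  where open Model t
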